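{- For all finite sums of resource expressions $\varepsilon,\varepsilon_0,\varepsilon_1\in\mathbb N[\Delta]$, if $\varepsilon\to_r\varepsilon_0$ and $\varepsilon\to_r\varepsilon_1$, then there is $\varepsilon'\in\mathbb N[\Delta]$ such that $\varepsilon_0\to_r^{=}\varepsilon'$ and $\varepsilon_1\to_r^{=}\varepsilon'$, where $\to_r^{=}$ is the reflexive closure of $\to_r$.
   Context: Fix a countably infinite set of variables. Resource terms $s::=x\mid\lambda x.s\mid\langle s\rangle\bar t$ and resource monomials $\bar t=[t_1,\dots,t_n]$ (finite multisets of resource terms), mutually inductively; terms up to $\alpha$-equivalence. A resource expression is a resource term or monomial; $\Delta$ denotes the set of resource terms or of monomials. $\mathbb N[\Delta]$ is the set of finite formal sums of resource expressions (free commutative monoid); constructors extend to finite sums linearly in each argument. Multilinear substitution: for $x\notin\mathrm{fv}(\bar u)$, with $x_1,\dots,x_m$ the free occurrences of $x$ in $e$ and $\bar u=[u_1,\dots,u_n]$, $e\langle\bar u/x\rangle=\sum_f e[u_1/x_{f(1)},\dots,u_n/x_{f(n)}]$ over bijections $f:\{1..n\}\to\{1..m\}$ ($0$ if $n\ne m$). Resource reduction $\to_r\subseteq\Delta\times\mathbb N[\Delta]$: $\langle\lambda x.s\rangle\bar t\to_r s\langle\bar t/x\rangle$; if $s\to_r\sigma'$ then $\lambda x.s\to_r\lambda x.\sigma'$, $\langle s\rangle\bar t\to_r\langle\sigma'\rangle\bar t$, $[s]\cdot\bar t\to_r[\sigma']\cdot\bar t$ ($\cdot$ = multiset union); if $\bar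 t\to_r\bar\tau'$ then $\langle s\rangle\bar t\to_r\langle s\rangle\bar\tau'$. On finite sums: $\varepsilon\to_r\varepsilon'$ iff $\varepsilon=\sum_{i=0}^n e_i$, $\varepsilon'=\sum_{i=0}^n\varepsilon'_i$, $e_0\to_r\varepsilon'_0$ and for each $i\ge1$, $e_i\to_r\varepsilon'_i$ or $\varepsilon'_i=e_i$. -}

module Defs where

open import Data.Nat using (ℕ; zero; suc; _≡ᵇ_; _<ᵇ_; pred)
open import Data.Bool using (if_then_else_)
open import Data.List using (List; []; _∷_; _++_; map; concatMap; length)
open import Data.List.Relation.Unary.All using (All)
open import Data.Product using (_×_; _,_; proj₁; proj₂; ∃; ∃-syntax)
open import Data.Sum using (_⊎_)
open import Relation.Binary.PropositionalEquality using (_≡_)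
import Data.List.Relation.Binary.Permutation.Homogeneous as Homogeneous

-- Resource expressions (de Bruijn indices, so alpha-equivalence is
-- syntactic equality).  A monomial is represented by a list of terms;
-- the multiset structure is recovered by the equivalence _≃_ below.

data Sort : Set where
  tm bg : Sort

infixr 5 _∷ᵇ_

data Exp : Sort → Set where
  var  : ℕ → Exp tm
  lam  : Exp tm → Exp tm
  app  : Exp tm → Exp bg → Exp tm
  []ᵇ  : Exp bg
  _∷ᵇ_ : Exp tm → Exp bg → Exp bg

Term : Set
Term = Exp tm

Bag : Set
Bag = Exp bg

-- Representation equivalence: monomials are multisets (order of
-- elements irrelevant), as a congruence on all resource expressions.
infix 4 _≃_
data _≃_ : {s : Sort} → Exp s → Exp s → Set where
  ≃-refl  : ∀ {s} {e : Exp s} → e ≃ e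
  ≃-sym   : ∀ {s} {e e' : Exp s} → e ≃ e' → e' ≃ e
  ≃-trans : ∀ {s} {e e' e'' : Exp s} → e ≃ e' → e' ≃ e'' → e ≃ e''
  ≃-lam   : ∀ {u u'} → u ≃ u' → lam u ≃ lam u'
  ≃-app   : ∀ {u u' b b'} → u ≃ u' → b ≃ b' → app u b ≃ app u' b'
  ≃-cons  : ∀ {u u' b b'} → u ≃ u' → b ≃ b' → (u ∷ᵇ b) ≃ (u' ∷ᵇ b')
  ≃-swap  : ∀ {u v b} → (u ∷ᵇ v ∷ᵇ b) ≃ (v ∷ᵇ u ∷ᵇ b)

-- Finite formal sums ℕ[Δ]: lists of expressions, identified up to
-- permutation and elementwise ≃ (free commutative monoid).

Sum : Sort → Set
Sum s = List (Exp s)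

infix 4 _≈_
_≈_ : ∀ {s} → Sum s → Sum s → Set
_≈_ = Homogeneous.Permutation _≃_

-- Multilinear substitution  e⟨ū/x⟩  where x is de Bruijn index 0 of e
-- (e is the body of a λ), ū lives in the outer context.

bagToList : Bag → List Term
bagToList []ᵇ = []
bagToList (t ∷ᵇ b) = t ∷ bagToList b

shift : ∀ {s} → ℕ → Exp s → Exp s
shift c (var k) = if k <ᵇ c then var k else var (suc k)
shift c (lam e) = lam (shift (suc c) e)
shift c (app e b) = app (shift c e) (shift c b)
shift c []ᵇ = []ᵇ
shift c (t ∷ᵇ b) = shift c t ∷ᵇ shift c b

weaken : ℕ → Term → Term
weaken zero u = u
weaken (suc d) u = shift 0 (weaken d u)

occ : ∀ {s} → ℕ → Exp s → ℕ
occ d (var k) = if k ≡ᵇ d then 1 else 0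
occ d (lam e) = occ (suc d) e
occ d (app e b) = occ d e Data.Nat.+ occ d b
occ d []ᵇ = 0
occ d (t ∷ᵇ b) = occ d t Data.Nat.+ occ d b

-- Replace the occurrences of the variable (index d under d binders),
-- from left to right, by the given terms in order; other free
-- variables above d are decremented (the binder disappears).
fill : ∀ {s} → ℕ → Exp s → List Term → Exp s × List Term
fill d (var k) us =
  if k ≡ᵇ d
  then (fillVar us)
  else ((if k <ᵇ d then var k else var (pred k)) , us)
  where
  fillVar : List Term → Term × List Term
  fillVar [] = var k , []
  fillVar (u ∷ us') = weaken d u , us'
fill d (lam e) us with fill (suc d) e us
... | e' , us' = lam e' , us'
fill d (app e b) us with fill d e us
... | e' , us₁ with fill d b us₁
... | b' , us₂ = app e' b' , us₂
fill d []ᵇ us = []ᵇ , us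
fill d (t ∷ᵇ b) us with fill d t us
... | t' , us₁ with fill d b us₁
... | b' , us₂ = (t' ∷ᵇ b') , us₂

-- all orderings of a list (one per bijection of positions)
insertions : {A : Set} → A → List A → List (List A)
insertions x [] = (x ∷ []) ∷ []
insertions x (y ∷ ys) = (x ∷ y ∷ ys) ∷ map (y ∷_) (insertions x ys)

orderings : {A : Set} → List A → List (List A)
orderings [] = [] ∷ []
orderings (x ∷ xs) = concatMap (insertions x) (orderings xs)

-- e⟨ū/x⟩ = Σ_f e[u₁/x_f(1), …, uₙ/x_f(n)] over bijections f, 0 if n ≠ m.
-- Summing over bijections f is the same as summing over orderings of
-- ū and filling the occurrences x₁,…,x_m left-to-right.
msubst : ∀ {s} → Exp s → Bag → Sum s
msubst e b =
  if length (bagToList b) ≡ᵇ occ 0 e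
  then map (λ us → proj₁ (fill 0 e us)) (orderings (bagToList b))
  else []

infix 4 _→r_
data _→r_ : {s : Sort} → Exp s → Sum s → Set where
  β     : ∀ {u b} → app (lam u) b →r msubst u b
  ξ-lam : ∀ {u σ} → u →r σ → lam u →r map lam σ
  ξ-appˡ : ∀ {u σ b} → u →r σ → app u b →r map (λ u' → app u' b) σ
  ξ-appʳ : ∀ {u b τ} → b →r τ → app u b →r map (app u) τ
  -- [s]·t̄ →r [σ']·t̄  (the monomial b is the multiset [s]·t̄)
  ξ-bag : ∀ {b u t σ} → b ≃ (u ∷ᵇ t) → u →r σ → b →r map (_∷ᵇ t) σ

-- Extension to finite sums: ε = Σ_{i=0}^n e_i, ε' = Σ ε'_i,
-- e₀ →r ε'₀ and, for i ≥ 1, e_i →r ε'_i or ε'_i = e_i.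
OptStep : ∀ {s} → Exp s × Sum s → Set
OptStep (e , σ) = (e →r σ) ⊎ (σ ≡ e ∷ [])

infix 4 _→rₛ_
data _→rₛ_ {s : Sort} (ε ε' : Sum s) : Set where
  sum-step : (e₀ : Exp s) (σ₀ : Sum s) (ps : List (Exp s × Sum s)) →
             e₀ →r σ₀ → All OptStep ps →
             ε ≈ e₀ ∷ map proj₁ ps →
             ε' ≈ σ₀ ++ concatMap proj₂ ps →
             ε →rₛ ε'

infix 4 _→rₛ⁼_
_→rₛ⁼_ : ∀ {s} → Sum s → Sum s → Set
ε →rₛ⁼ ε' = (ε ≈ ε') ⊎ (ε →rₛ ε')

{-# OPTIONS --safe #-}
-- A single →r step has a local diamond property up to Par, the reduction of sums in
-- which every summand makes at most one step.  Par is closed under sums and under all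
-- constructors, and every Par step is a →rₛ⁼ step, so two →rₛ steps from the same sum
-- are joined summand by summand.  Apart from disjoint redexes, the critical pairs are
-- β against a step in the argument or in the body of the redex.  They close because
-- multilinear substitution commutes with reduction: a step of an argument distributes
-- over the substitution, and a step of the body commutes with it.  The latter creates
-- nested substitutions, reorganised by the substitution lemma (msub-composition).

module Submission where

open import Level using (Level)
open import Data.Bool using (true; false; if_then_else_)
open import Data.Empty using (⊥-elim)
open import Data.List using (List; []; _∷_; _++_; map; concatMap; length; take; drop)
open import Data.List.Properties using (map-++; map-∘; map-cong; map-cong-local; map-id; concatMap-cong; map-concatMap; concatMap-++; concatMap-map) renaming (++-assoc to ++-assoc-≡; ++-identityʳ to ++-identityʳ-≡)
open import Data.List.Relation.Unary.All using (All; []; _∷_)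
import Data.List.Relation.Unary.All as All
import Data.List.Relation.Unary.All.Properties as All
import Data.List.Relation.Binary.Pointwise as PW
import Data.List.Relation.Binary.Permutation.Homogeneous as Hom
import Data.List.Relation.Binary.Permutation.Setoid as PermS
import Data.List.Relation.Binary.Permutation.Setoid.Properties as PermP
open import Data.Nat using (ℕ; zero; suc; _≡ᵇ_; _<ᵇ_; pred; _+_; _<_; _≤_; z≤n; s≤s; _≟_)
open import Data.Nat.Properties using (0≢1+n; ≤-reflexive; <⇒≤pred; ≤-refl; ≤-trans; <-cmp; n≤1+n; <⇒≤; ≤-pred; +-suc; m≤m+n; <-irrefl; ≤-<-trans; <⇒≢; suc-injective; +-cancelˡ-≡)
open import Data.Product using (_×_; _,_; proj₁; proj₂; ∃; ∃-syntax; Σ-syntax; uncurry)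
open import Data.Sum using (_⊎_; inj₁; inj₂)
open import Relation.Binary.Bundles using (Setoid)
open import Relation.Binary.Core using (Rel)
open import Relation.Binary.Definitions using (tri<; tri≈; tri>)
open import Relation.Binary.PropositionalEquality using (_≡_; _≢_; refl; sym; cong; cong₂; trans; subst; subst₂)
open import Relation.Nullary using (¬_; yes; no)

open import Defs

-- Sums over splittings and orderings of a list

splits : {B : Set} → List B → List (List B × List B)
splits [] = ([] , []) ∷ []
splits (x ∷ xs) = map (λ p → (x ∷ proj₁ p , proj₂ p)) (splits xs) ++ map (λ p → (proj₁ p , x ∷ proj₂ p)) (splits xs)

picks : {B : Set} → List B → List (B × List B)
picks [] = []
picks (x ∷ xs) = (x , xs) ∷ map (λ p → (proj₁ p , x ∷ proj₂ p)) (picks xs)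

module SetoidSums {a ℓ} (S : Setoid a ℓ) where
  open Setoid S using () renaming (Carrier to A)
  open PermS S public hiding (refl; trans; prep; swap)
  open PermS S public using (prep; swap)
  open PermP S public

  private variable
    i : Level

  concatMap-↭ : ∀ {I : Set i} {f g : I → List A} (xs : List I) → (∀ x → f x ↭ g x) → concatMap f xs ↭ concatMap g xs
  concatMap-↭ [] h = ↭-refl
  concatMap-↭ (x ∷ xs) h = ++⁺ (h x) (concatMap-↭ xs h)

  concatMap-↭-All : ∀ {I : Set i} {f g : I → List A} {xs : List I} → All (λ x → f x ↭ g x) xs → concatMap f xs ↭ concatMap g xs
  concatMap-↭-All [] = ↭-refl
  concatMap-↭-All (p ∷ ps) = ++⁺ p (concatMap-↭-All ps)

  concatMap-const-[] : ∀ {I : Set i} (xs : List I) → concatMap {B = A} (λ _ → []) xs ≡ []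
  concatMap-const-[] [] = refl
  concatMap-const-[] (x ∷ xs) = concatMap-const-[] xs

  ++-medial : ∀ a b c d → (a ++ b) ++ (c ++ d) ↭ (a ++ c) ++ (b ++ d)
  ++-medial a b c d =
    ↭-trans (↭-reflexive (++-assoc-≡ a b (c ++ d)))
   (↭-trans (++⁺ˡ a (shifts b c))
            (↭-reflexive (sym (++-assoc-≡ a c (b ++ d)))))

  concatMap-++-distrib : ∀ {I : Set i} (f g : I → List A) xs → concatMap (λ x → f x ++ g x) xs ↭ concatMap f xs ++ concatMap g xs
  concatMap-++-distrib f g [] = ↭-refl
  concatMap-++-distrib f g (x ∷ xs) = ↭-trans (++⁺ˡ (f x ++ g x) (concatMap-++-distrib f g xs)) (++-medial (f x) (g x) (concatMap f xs) (concatMap g xs))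

  concatMap-comm : ∀ {I J : Set i} (h : I → J → List A) (xs : List I) (ys : List J) →
           concatMap (λ x → concatMap (h x) ys) xs ↭ concatMap (λ y → concatMap (λ x → h x y) xs) ys
  concatMap-comm h [] ys = ↭-reflexive (sym (concatMap-const-[] ys))
  concatMap-comm h (x ∷ xs) ys = ↭-trans (++⁺ˡ (concatMap (h x) ys) (concatMap-comm h xs ys))
                          (↭-sym (concatMap-++-distrib (h x) (λ y → concatMap (λ x → h x y) xs) ys))

  infixr 4 _⊚_
  _⊚_ : ∀ {xs ys zs} → xs ↭ ys → ys ↭ zs → xs ↭ zs
  _⊚_ = ↭-trans

  module _ {B : Set} where
    Σsplits : List B → (List B → List B → List A) → List A
    Σsplits L K = concatMap (uncurry K) (splits L)

    Σsplits-∷ : ∀ x xs K → Σsplits (x ∷ xs) K ≡ Σsplits xs (λ X Y → K (x ∷ X) Y) ++ Σsplits xs (λ X Y → K X (x ∷ Y))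
    Σsplits-∷ x xs K rewrite concatMap-++ (uncurry K) (map (λ p → (x ∷ proj₁ p , proj₂ p)) (splits xs)) (map (λ p → (proj₁ p , x ∷ proj₂ p)) (splits xs))
                           | concatMap-map (uncurry K) (λ p → (x ∷ proj₁ p , proj₂ p)) (splits xs)
                           | concatMap-map (uncurry K) (λ p → (proj₁ p , x ∷ proj₂ p)) (splits xs) = refl

    Σsplits-↭ : ∀ L {K K'} → (∀ X Y → K X Y ↭ K' X Y) → Σsplits L K ↭ Σsplits L K'
    Σsplits-↭ L h = concatMap-↭ (splits L) (λ p → h (proj₁ p) (proj₂ p))

    Σsplits-++ : ∀ L K K' → Σsplits L (λ X Y → K X Y ++ K' X Y) ↭ Σsplits L K ++ Σsplits L K'
    Σsplits-++ L K K' = concatMap-++-distrib (uncurry K) (uncurry K') (splits L)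

    Σsplits-swap : ∀ L K → Σsplits L K ↭ Σsplits L (λ X Y → K Y X)
    Σsplits-swap [] K = ↭-refl
    Σsplits-swap (x ∷ xs) K =
      ↭-reflexive (Σsplits-∷ x xs K)
      ⊚ ++⁺ (Σsplits-swap xs (λ X Y → K (x ∷ X) Y)) (Σsplits-swap xs (λ X Y → K X (x ∷ Y)))
      ⊚ ++-comm (Σsplits xs (λ X Y → K (x ∷ Y) X)) (Σsplits xs (λ X Y → K Y (x ∷ X)))
      ⊚ ↭-reflexive (sym (Σsplits-∷ x xs (λ X Y → K Y X)))

    Σsplits-assoc : ∀ L (K : List B → List B → List B → List A) →
      Σsplits L (λ X Y → Σsplits Y (λ Y1 Y2 → K X Y1 Y2)) ↭ Σsplits L (λ Z Y2 → Σsplits Z (λ X Y1 → K X Y1 Y2))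
    Σsplits-assoc [] K = ↭-refl
    Σsplits-assoc (x ∷ xs) K =
      ↭-reflexive (Σsplits-∷ x xs _)
      ⊚ ++⁺ˡ (Σsplits xs (λ X Y → Σsplits Y (λ Y1 Y2 → K (x ∷ X) Y1 Y2)))
             (Σsplits-↭ xs (λ X Y → ↭-reflexive (Σsplits-∷ x Y (K X))) ⊚ Σsplits-++ xs (λ X Y → Σsplits Y (λ Y1 Y2 → K X (x ∷ Y1) Y2)) (λ X Y → Σsplits Y (λ Y1 Y2 → K X Y1 (x ∷ Y2))))
      ⊚ ++⁺ (Σsplits-assoc xs (λ X Y1 Y2 → K (x ∷ X) Y1 Y2))
            (++⁺ (Σsplits-assoc xs (λ X Y1 Y2 → K X (x ∷ Y1) Y2)) (Σsplits-assoc xs (λ X Y1 Y2 → K X Y1 (x ∷ Y2))))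
      ⊚ ↭-reflexive (sym (++-assoc-≡ (Σsplits xs (λ Z Y2 → Σsplits Z (λ X Y1 → K (x ∷ X) Y1 Y2)))
                             (Σsplits xs (λ Z Y2 → Σsplits Z (λ X Y1 → K X (x ∷ Y1) Y2)))
                             (Σsplits xs (λ Z Y2 → Σsplits Z (λ X Y1 → K X Y1 (x ∷ Y2))))))
      ⊚ ++⁺ʳ _ (↭-sym (Σsplits-++ xs (λ Z Y2 → Σsplits Z (λ X Y1 → K (x ∷ X) Y1 Y2)) (λ Z Y2 → Σsplits Z (λ X Y1 → K X (x ∷ Y1) Y2))) ⊚ Σsplits-↭ xs (λ Z Y2 → ↭-reflexive (sym (Σsplits-∷ x Z (λ X Y1 → K X Y1 Y2)))))
      ⊚ ↭-reflexive (sym (Σsplits-∷ x xs _))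

    ifLength : ℕ → List B → List A → List A
    ifLength k X Y = if length X ≡ᵇ k then Y else []

    Σpicks : List B → (B → List B → List A) → List A
    Σpicks L F = concatMap (uncurry F) (picks L)

    Σpicks-∷ : ∀ x xs F → Σpicks (x ∷ xs) F ≡ F x xs ++ Σpicks xs (λ y r → F y (x ∷ r))
    Σpicks-∷ x xs F = cong (F x xs ++_) (concatMap-map (uncurry F) (λ p → (proj₁ p , x ∷ proj₂ p)) (picks xs))

    concatMap-concatMap : ∀ {I J : Set} (f : J → List A) (g : I → List J) xs → concatMap f (concatMap g xs) ≡ concatMap (λ x → concatMap f (g x)) xs
    concatMap-concatMap f g [] = refl
    concatMap-concatMap f g (x ∷ xs) rewrite concatMap-++ f (g x) (concatMap g xs) = cong (concatMap f (g x) ++_) (concatMap-concatMap f g xs)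

    Σlater-insertions : B → (List B → List A) → List B → List A
    Σlater-insertions x H [] = []
    Σlater-insertions x H (z ∷ zs) = concatMap (λ w → H (z ∷ w)) (insertions x zs)

    concatMap-insertions : ∀ x H o → concatMap H (insertions x o) ≡ H (x ∷ o) ++ Σlater-insertions x H o
    concatMap-insertions x H [] = refl
    concatMap-insertions x H (z ∷ zs) = cong (H (x ∷ z ∷ zs) ++_) (concatMap-map H (z ∷_) (insertions x zs))

    Σorderings-by-head : ∀ x xs (H : List B → List A) →
      concatMap H (orderings (x ∷ xs)) ↭ Σpicks (x ∷ xs) (λ y L' → concatMap (λ o → H (y ∷ o)) (orderings L'))
    Σorderings-by-head x xs H =
      ↭-reflexive (concatMap-concatMap H (insertions x) (orderings xs))
      ⊚ concatMap-↭ (orderings xs) (λ o → ↭-reflexive (concatMap-insertions x H o))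
      ⊚ concatMap-++-distrib (λ o → H (x ∷ o)) (Σlater-insertions x H) (orderings xs)
      ⊚ ++⁺ˡ (concatMap (λ o → H (x ∷ o)) (orderings xs)) (rest xs)
      ⊚ ↭-reflexive (sym (Σpicks-∷ x xs (λ y L' → concatMap (λ o → H (y ∷ o)) (orderings L'))))
      where
      rest : ∀ xs → concatMap (Σlater-insertions x H) (orderings xs) ↭ Σpicks xs (λ y r → concatMap (λ o → H (y ∷ o)) (orderings (x ∷ r)))
      rest [] = ↭-refl
      rest (z ∷ zs) =
        Σorderings-by-head z zs (Σlater-insertions x H)
        ⊚ concatMap-↭ (picks (z ∷ zs)) (λ p → ↭-reflexive (sym (concatMap-concatMap (λ o → H (proj₁ p ∷ o)) (insertions x) (orderings (proj₂ p)))))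

    Σpicks-Σsplits : ∀ L (K : B → List B → List B → List A) →
      Σpicks L (λ y L' → Σsplits L' (K y)) ↭ Σsplits L (λ A' Bs → Σpicks A' (λ y A → K y A Bs))
    Σpicks-Σsplits [] K = ↭-refl
    Σpicks-Σsplits (x ∷ xs) K =
      ↭-reflexive (Σpicks-∷ x xs (λ y L' → Σsplits L' (K y)))
      ⊚ ++⁺ˡ (Σsplits xs (K x))
          (concatMap-↭ (picks xs) (λ p → ↭-reflexive (Σsplits-∷ x (proj₂ p) (K (proj₁ p))))
           ⊚ concatMap-++-distrib (λ p → Σsplits (proj₂ p) (λ A Bs → K (proj₁ p) (x ∷ A) Bs)) (λ p → Σsplits (proj₂ p) (λ A Bs → K (proj₁ p) A (x ∷ Bs))) (picks xs)
           ⊚ ++⁺ (Σpicks-Σsplits xs (λ y A Bs → K y (x ∷ A) Bs)) (Σpicks-Σsplits xs (λ y A Bs → K y A (x ∷ Bs))))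
      ⊚ ↭-reflexive (sym (++-assoc-≡ (Σsplits xs (K x)) (Σsplits xs (λ A' Bs → Σpicks A' (λ y A → K y (x ∷ A) Bs))) (Σsplits xs (λ A' Bs → Σpicks A' (λ y A → K y A (x ∷ Bs))))))
      ⊚ ++⁺ʳ (Σsplits xs (λ A' Bs → Σpicks A' (λ y A → K y A (x ∷ Bs))))
          (↭-sym (Σsplits-++ xs (K x) (λ A' Bs → Σpicks A' (λ y A → K y (x ∷ A) Bs)))
           ⊚ Σsplits-↭ xs (λ A' Bs → ↭-reflexive (sym (Σpicks-∷ x A' (λ y A → K y A Bs)))))
      ⊚ ↭-reflexive (sym (Σsplits-∷ x xs (λ A' Bs → Σpicks A' (λ y A → K y A Bs))))

    picks-length : ∀ L → All (λ (p : B × List B) → length L ≡ suc (length (proj₂ p))) (picks L)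
    picks-length [] = []
    picks-length (x ∷ xs) = refl ∷ go (picks xs) (picks-length xs)
      where
      go : ∀ ps → All (λ p → length xs ≡ suc (length (proj₂ p))) ps →
           All (λ p → suc (length xs) ≡ suc (length (proj₂ p))) (map (λ p → (proj₁ p , x ∷ proj₂ p)) ps)
      go [] [] = []
      go (p ∷ ps) (e ∷ es) = cong suc e ∷ go ps es

    concatMap-if : ∀ {I : Set} b (f : I → List A) xs → concatMap (λ x → if b then f x else []) xs ≡ (if b then concatMap f xs else [])
    concatMap-if true f xs = refl
    concatMap-if false f xs = concatMap-const-[] xs

    if-↭ : ∀ b {X Y} → X ↭ Y → (if b then X else []) ↭ (if b then Y else [])
    if-↭ true p = p
    if-↭ false p = ↭-refl

    Σsplits-ifLength-0 : ∀ L (H : List B → List B → List A) → Σsplits L (λ X Y → ifLength 0 X (H X Y)) ↭ H [] L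
    Σsplits-ifLength-0 [] H = ++-identityʳ (H [] [])
    Σsplits-ifLength-0 (x ∷ xs) H = ↭-reflexive (Σsplits-∷ x xs (λ X Y → ifLength 0 X (H X Y)))
      ⊚ ↭-reflexive (cong (_++ Σsplits xs (λ X Y → ifLength 0 X (H X (x ∷ Y)))) (concatMap-const-[] (splits xs)))
      ⊚ Σsplits-ifLength-0 xs (λ X Y → H X (x ∷ Y))

    Σorderings-take-drop : ∀ k L → k ≤ length L → ∀ (G : List B → List B → List A) →
      concatMap (λ o → G (take k o) (drop k o)) (orderings L)
        ↭ Σsplits L (λ X Y → ifLength k X (concatMap (λ a → concatMap (G a) (orderings Y)) (orderings X)))
    Σorderings-take-drop zero L _ G = ↭-sym (Σsplits-ifLength-0 L (λ X Y → concatMap (λ a → concatMap (G a) (orderings Y)) (orderings X)) ⊚ ++-identityʳ (concatMap (G []) (orderings L)))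
    Σorderings-take-drop (suc k) (x ∷ xs) (s≤s le) G =
      Σorderings-by-head x xs (λ o → G (take (suc k) o) (drop (suc k) o))
      ⊚ concatMap-↭-All {f = uncurry (λ y L' → concatMap (λ o → G (take (suc k) (y ∷ o)) (drop (suc k) (y ∷ o))) (orderings L'))}
                 {g = uncurry (λ y L' → Σsplits L' (λ A Bs → ifLength k A (concatMap (λ a → concatMap (G (y ∷ a)) (orderings Bs)) (orderings A))))} {xs = picks (x ∷ xs)}
                 (All.map (λ {p} e → Σorderings-take-drop k (proj₂ p) (le' p e) (λ a b → G (proj₁ p ∷ a) b)) (picks-length (x ∷ xs)))
      ⊚ Σpicks-Σsplits (x ∷ xs) (λ y A Bs → ifLength k A (concatMap (λ a → concatMap (G (y ∷ a)) (orderings Bs)) (orderings A)))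
      ⊚ Σsplits-↭ (x ∷ xs) fin
      where
      le' : ∀ p → suc (length xs) ≡ suc (length (proj₂ p)) → k ≤ length (proj₂ p)
      le' p e = subst (k ≤_) (suc-injective e) le
      fin : ∀ A' Bs → Σpicks A' (λ y A → ifLength k A (concatMap (λ a → concatMap (G (y ∷ a)) (orderings Bs)) (orderings A)))
                      ↭ ifLength (suc k) A' (concatMap (λ a → concatMap (G a) (orderings Bs)) (orderings A'))
      fin [] Bs = ↭-refl
      fin (z ∷ zs) Bs =
        concatMap-↭-All {f = uncurry (λ y A → ifLength k A (concatMap (λ a → concatMap (G (y ∷ a)) (orderings Bs)) (orderings A)))}
                 {g = uncurry (λ y A → ifLength k zs (concatMap (λ a → concatMap (G (y ∷ a)) (orderings Bs)) (orderings A)))} {xs = picks (z ∷ zs)}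
                 (All.map (λ {p} e → ↭-reflexive (cong (λ n → if n ≡ᵇ k then concatMap (λ a → concatMap (G (proj₁ p ∷ a)) (orderings Bs)) (orderings (proj₂ p)) else []) (suc-injective (sym e)))) (picks-length (z ∷ zs)))
        ⊚ ↭-reflexive (concatMap-if (length zs ≡ᵇ k) (uncurry (λ y A → concatMap (λ a → concatMap (G (y ∷ a)) (orderings Bs)) (orderings A))) (picks (z ∷ zs)))
        ⊚ if-↭ (length zs ≡ᵇ k) (↭-sym (Σorderings-by-head z zs (λ a → concatMap (G a) (orderings Bs))))

    module SplitsPermutation {r} (R : Rel B r) (R-refl : ∀ {x} → R x x) where
      P = Hom.Permutation R
      P-refl : ∀ {X} → P X X
      P-refl = Hom.refl (PW.refl R-refl)

      Respects-P₂ : (List B → List B → List A) → Set _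
      Respects-P₂ K = ∀ {X X' Y Y'} → P X X' → P Y Y' → K X Y ↭ K X' Y'

      Σsplits-Pointwise : ∀ {L L'} → PW.Pointwise R L L' → ∀ K → Respects-P₂ K → Σsplits L K ↭ Σsplits L' K
      Σsplits-Pointwise PW.[] K rk = ↭-refl
      Σsplits-Pointwise {x ∷ xs} {y ∷ ys} (xy PW.∷ pw) K rk =
        ↭-reflexive (Σsplits-∷ x xs K)
        ⊚ ++⁺ (Σsplits-Pointwise pw (λ X Y → K (x ∷ X) Y) (λ p q → rk (Hom.prep R-refl p) q) ⊚ Σsplits-↭ ys (λ X Y → rk (Hom.prep xy P-refl) P-refl))
              (Σsplits-Pointwise pw (λ X Y → K X (x ∷ Y)) (λ p q → rk p (Hom.prep R-refl q)) ⊚ Σsplits-↭ ys (λ X Y → rk P-refl (Hom.prep xy P-refl)))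
        ⊚ ↭-reflexive (sym (Σsplits-∷ y ys K))

      Σsplits-Permutation : ∀ {L L'} → P L L' → ∀ K → Respects-P₂ K → Σsplits L K ↭ Σsplits L' K
      Σsplits-Permutation (Hom.refl pw) K rk = Σsplits-Pointwise pw K rk
      Σsplits-Permutation {x ∷ xs} {y ∷ ys} (Hom.prep xy p) K rk =
        ↭-reflexive (Σsplits-∷ x xs K)
        ⊚ ++⁺ (Σsplits-Permutation p (λ X Y → K (x ∷ X) Y) (λ p q → rk (Hom.prep R-refl p) q) ⊚ Σsplits-↭ ys (λ X Y → rk (Hom.prep xy P-refl) P-refl))
              (Σsplits-Permutation p (λ X Y → K X (x ∷ Y)) (λ p q → rk p (Hom.prep R-refl q)) ⊚ Σsplits-↭ ys (λ X Y → rk P-refl (Hom.prep xy P-refl)))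
        ⊚ ↭-reflexive (sym (Σsplits-∷ y ys K))
      Σsplits-Permutation {x ∷ y ∷ xs} {y' ∷ x' ∷ ys} (Hom.swap e1 e2 p) K rk =
        ↭-reflexive (Σsplits-∷ x (y ∷ xs) K)
        ⊚ ++⁺ (↭-reflexive (Σsplits-∷ y xs (λ X Y → K (x ∷ X) Y))) (↭-reflexive (Σsplits-∷ y xs (λ X Y → K X (x ∷ Y))))
        ⊚ ++⁺ (++⁺ g1 g2) (++⁺ g3 g4)
        ⊚ ++-medial (Σsplits ys (λ X Y → K (y' ∷ x' ∷ X) Y)) (Σsplits ys (λ X Y → K (x' ∷ X) (y' ∷ Y)))
               (Σsplits ys (λ X Y → K (y' ∷ X) (x' ∷ Y))) (Σsplits ys (λ X Y → K X (y' ∷ x' ∷ Y)))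
        ⊚ ++⁺ (↭-reflexive (sym (Σsplits-∷ x' ys (λ X Y → K (y' ∷ X) Y)))) (↭-reflexive (sym (Σsplits-∷ x' ys (λ X Y → K X (y' ∷ Y)))))
        ⊚ ↭-reflexive (sym (Σsplits-∷ y' (x' ∷ ys) K))
        where
        g1 : Σsplits xs (λ X Y → K (x ∷ y ∷ X) Y) ↭ Σsplits ys (λ X Y → K (y' ∷ x' ∷ X) Y)
        g1 = Σsplits-Permutation p (λ X Y → K (x ∷ y ∷ X) Y) (λ p q → rk (Hom.prep R-refl (Hom.prep R-refl p)) q)
             ⊚ Σsplits-↭ ys (λ X Y → rk (Hom.swap e1 e2 P-refl) P-refl)
        g2 : Σsplits xs (λ X Y → K (x ∷ X) (y ∷ Y)) ↭ Σsplits ys (λ X Y → K (x' ∷ X) (y' ∷ Y))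
        g2 = Σsplits-Permutation p (λ X Y → K (x ∷ X) (y ∷ Y)) (λ p q → rk (Hom.prep R-refl p) (Hom.prep R-refl q))
             ⊚ Σsplits-↭ ys (λ X Y → rk (Hom.prep e1 P-refl) (Hom.prep e2 P-refl))
        g3 : Σsplits xs (λ X Y → K (y ∷ X) (x ∷ Y)) ↭ Σsplits ys (λ X Y → K (y' ∷ X) (x' ∷ Y))
        g3 = Σsplits-Permutation p (λ X Y → K (y ∷ X) (x ∷ Y)) (λ p q → rk (Hom.prep R-refl p) (Hom.prep R-refl q))
             ⊚ Σsplits-↭ ys (λ X Y → rk (Hom.prep e2 P-refl) (Hom.prep e1 P-refl))
        g4 : Σsplits xs (λ X Y → K X (x ∷ y ∷ Y)) ↭ Σsplits ys (λ X Y → K X (y' ∷ x' ∷ Y))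
        g4 = Σsplits-Permutation p (λ X Y → K X (x ∷ y ∷ Y)) (λ p q → rk p (Hom.prep R-refl (Hom.prep R-refl q)))
             ⊚ Σsplits-↭ ys (λ X Y → rk P-refl (Hom.swap e1 e2 P-refl))
      Σsplits-Permutation (Hom.trans p q) K rk = Σsplits-Permutation p K rk ⊚ Σsplits-Permutation q K rk

  module _ {I : Set} {r} (R : Rel I r) where
    concatMap-Permutation : ∀ {X X'} (h : I → List A) → Hom.Permutation R X X' → (∀ {x x'} → R x x' → h x ↭ h x') → concatMap h X ↭ concatMap h X'
    concatMap-Permutation h (Hom.refl pw) hr = go pw
      where
      go : ∀ {X X'} → PW.Pointwise R X X' → concatMap h X ↭ concatMap h X'
      go PW.[] = ↭-refl
      go (e PW.∷ pw) = ++⁺ (hr e) (go pw)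
    concatMap-Permutation h (Hom.prep e p) hr = ++⁺ (hr e) (concatMap-Permutation h p hr)
    concatMap-Permutation h (Hom.swap {xs} {ys} {x} {y} {x'} {y'} e1 e2 p) hr =
      ↭-reflexive (sym (++-assoc-≡ (h x) (h y) (concatMap h xs)))
      ⊚ ++⁺ (++-comm (h x) (h y) ⊚ ++⁺ (hr e2) (hr e1)) (concatMap-Permutation h p hr)
      ⊚ ↭-reflexive (++-assoc-≡ (h y') (h x') (concatMap h ys))
    concatMap-Permutation h (Hom.trans p q) hr = concatMap-Permutation h p hr ⊚ concatMap-Permutation h q hr

  module _ {B : Set} where
    Σsplits-exchange : ∀ L (K : List B → List B → List B → List A) →
      Σsplits L (λ X Y → Σsplits Y (λ Y1 Y2 → K X Y1 Y2)) ↭ Σsplits L (λ X Y → Σsplits Y (λ Y1 Y2 → K Y1 X Y2))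
    Σsplits-exchange L K =
      Σsplits-assoc L K
      ⊚ Σsplits-↭ L (λ Z Y2 → Σsplits-swap Z (λ X Y1 → K X Y1 Y2))
      ⊚ ↭-sym (Σsplits-assoc L (λ X Y1 Y2 → K Y1 X Y2))

    Σsplits-transpose : ∀ L (K : List B → List B → List B → List B → List A) →
      Σsplits L (λ L1 L2 → Σsplits L1 (λ A1 B1 → Σsplits L2 (λ A2 B2 → K A1 B1 A2 B2)))
      ↭ Σsplits L (λ P Q → Σsplits P (λ A1 A2 → Σsplits Q (λ B1 B2 → K A1 B1 A2 B2)))
    Σsplits-transpose L K =
      ↭-sym (Σsplits-assoc L (λ X Y1 Y2 → Σsplits Y2 (λ A2 B2 → K X Y1 A2 B2)))
      ⊚ Σsplits-↭ L (λ A1 Y → Σsplits-exchange Y (λ X Y1 Y2 → K A1 X Y1 Y2))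
      ⊚ Σsplits-assoc L (λ X Y1 Y2 → Σsplits Y2 (λ B1 B2 → K X B1 Y1 B2))

-- Inversion for ≃, shifting and monomials as lists

≃-setoid : Sort → Setoid _ _
≃-setoid s = record { Carrier = Exp s ; _≈_ = _≃_ ; isEquivalence = record { refl = ≃-refl ; sym = ≃-sym ; trans = ≃-trans } }

module Sums {s : Sort} = SetoidSums (≃-setoid s)
open Sums.SplitsPermutation using (Σsplits-Permutation)
open Sums using (_↭_; _⊚_; ↭-reflexive; ↭-refl; ↭-sym; ↭-trans; ++⁺; ++⁺ˡ; ++⁺ʳ; concatMap-↭; concatMap-↭-All; concatMap-const-[]; Σsplits; Σsplits-↭; Σsplits-∷; concatMap-++-distrib; ++-identityʳ; concatMap-Permutation; concatMap-comm; concatMap-concatMap; ifLength; map⁺; shifts; xs↭ys⇒|xs|≡|ys|; Σorderings-take-drop; Σsplits-++; Σsplits-assoc; Σsplits-exchange; Σsplits-swap; Σsplits-transpose; ↭-shift; ↭-split)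

<ᵇ-true : ∀ {k c} → k < c → (k <ᵇ c) ≡ true
<ᵇ-true {zero} {suc c} _ = refl
<ᵇ-true {suc k} {suc c} (s≤s p) = <ᵇ-true p

<ᵇ-false : ∀ {k c} → c ≤ k → (k <ᵇ c) ≡ false
<ᵇ-false {k} {zero} _ = refl
<ᵇ-false {suc k} {suc c} (s≤s p) = <ᵇ-false p

≡ᵇ-refl : ∀ k → (k ≡ᵇ k) ≡ true
≡ᵇ-refl zero = refl
≡ᵇ-refl (suc k) = ≡ᵇ-refl k

≡ᵇ-false : ∀ {k d} → ¬ (k ≡ d) → (k ≡ᵇ d) ≡ false
≡ᵇ-false {zero} {zero} ne = ⊥-elim (ne refl)
≡ᵇ-false {zero} {suc d} ne = refl
≡ᵇ-false {suc k} {zero} ne = refl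
≡ᵇ-false {suc k} {suc d} ne = ≡ᵇ-false (λ e → ne (cong suc e))

-- ≃ has sym and trans constructors, so it is inverted through functions that respect it.
headTag : ∀ {s} → Exp s → ℕ
headTag (var _) = 0
headTag (lam _) = 1
headTag (app _ _) = 2
headTag []ᵇ = 3
headTag (_ ∷ᵇ _) = 4

lamBody : ∀ {s} → Exp s → Term
lamBody (lam u) = u
lamBody _ = var 0

appFun : ∀ {s} → Exp s → Term
appFun (app u _) = u
appFun _ = var 0

appArg : ∀ {s} → Exp s → Bag
appArg (app _ b) = b
appArg _ = []ᵇ

headTag-≃ : ∀ {s} {e e' : Exp s} → e ≃ e' → headTag e ≡ headTag e'
headTag-≃ ≃-refl = refl
headTag-≃ (≃-sym p) = sym (headTag-≃ p)
headTag-≃ (≃-trans p q) = trans (headTag-≃ p) (headTag-≃ q)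
headTag-≃ (≃-lam p) = refl
headTag-≃ (≃-app p q) = refl
headTag-≃ (≃-cons p q) = refl
headTag-≃ ≃-swap = refl

lamBody-≃ : ∀ {s} {e e' : Exp s} → e ≃ e' → lamBody e ≃ lamBody e'
lamBody-≃ ≃-refl = ≃-refl
lamBody-≃ (≃-sym p) = ≃-sym (lamBody-≃ p)
lamBody-≃ (≃-trans p q) = ≃-trans (lamBody-≃ p) (lamBody-≃ q)
lamBody-≃ (≃-lam p) = p
lamBody-≃ (≃-app p q) = ≃-refl
lamBody-≃ (≃-cons p q) = ≃-refl
lamBody-≃ ≃-swap = ≃-refl

appFun-≃ : ∀ {s} {e e' : Exp s} → e ≃ e' → appFun e ≃ appFun e'
appFun-≃ ≃-refl = ≃-refl
appFun-≃ (≃-sym p) = ≃-sym (appFun-≃ p)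
appFun-≃ (≃-trans p q) = ≃-trans (appFun-≃ p) (appFun-≃ q)
appFun-≃ (≃-lam p) = ≃-refl
appFun-≃ (≃-app p q) = p
appFun-≃ (≃-cons p q) = ≃-refl
appFun-≃ ≃-swap = ≃-refl

appArg-≃ : ∀ {s} {e e' : Exp s} → e ≃ e' → appArg e ≃ appArg e'
appArg-≃ ≃-refl = ≃-refl
appArg-≃ (≃-sym p) = ≃-sym (appArg-≃ p)
appArg-≃ (≃-trans p q) = ≃-trans (appArg-≃ p) (appArg-≃ q)
appArg-≃ (≃-lam p) = ≃-refl
appArg-≃ (≃-app p q) = q
appArg-≃ (≃-cons p q) = ≃-refl
appArg-≃ ≃-swap = ≃-refl

lam-≃-inv : ∀ {u e} → lam u ≃ e → ∃[ u' ] (e ≡ lam u' × u ≃ u')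
lam-≃-inv {u} {e} p = go e (headTag-≃ p) (lamBody-≃ p)
  where
  go : ∀ e → 1 ≡ headTag e → u ≃ lamBody e → ∃[ u' ] (e ≡ lam u' × u ≃ u')
  go (lam u') _ q = u' , refl , q

app-≃-inv : ∀ {u b e} → app u b ≃ e → ∃[ u' ] ∃[ b' ] (e ≡ app u' b' × u ≃ u' × b ≃ b')
app-≃-inv {u} {b} {e} p = go e (headTag-≃ p) (appFun-≃ p) (appArg-≃ p)
  where
  go : ∀ e → 2 ≡ headTag e → u ≃ appFun e → b ≃ appArg e → ∃[ u' ] ∃[ b' ] (e ≡ app u' b' × u ≃ u' × b ≃ b')
  go (app u' b') _ q r = u' , b' , refl , q , r

listToBag : List Term → Bag
listToBag [] = []ᵇ
listToBag (t ∷ ts) = t ∷ᵇ listToBag ts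

listToBag-bagToList : ∀ b → listToBag (bagToList b) ≡ b
listToBag-bagToList []ᵇ = refl
listToBag-bagToList (t ∷ᵇ b) = cong (t ∷ᵇ_) (listToBag-bagToList b)

toList : ∀ {s} → Exp s → List Term
toList (var k) = var k ∷ []
toList (lam u) = lam u ∷ []
toList (app u b) = app u b ∷ []
toList []ᵇ = []
toList (t ∷ᵇ b) = t ∷ toList b

toList-bag : ∀ b → toList b ≡ bagToList b
toList-bag []ᵇ = refl
toList-bag (t ∷ᵇ b) = cong (t ∷_) (toList-bag b)

≃⇒toList-↭ : ∀ {s} {e e' : Exp s} → e ≃ e' → toList e ↭ toList e'
≃⇒toList-↭ ≃-refl = ↭-refl
≃⇒toList-↭ (≃-sym p) = ↭-sym (≃⇒toList-↭ p)
≃⇒toList-↭ (≃-trans p q) = ↭-trans (≃⇒toList-↭ p) (≃⇒toList-↭ q)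
≃⇒toList-↭ (≃-lam p) = Hom.prep (≃-lam p) ↭-refl
≃⇒toList-↭ (≃-app p q) = Hom.prep (≃-app p q) ↭-refl
≃⇒toList-↭ (≃-cons p q) = Hom.prep p (≃⇒toList-↭ q)
≃⇒toList-↭ ≃-swap = Hom.swap ≃-refl ≃-refl ↭-refl

≃⇒bagToList-↭ : ∀ {b b'} → b ≃ b' → bagToList b ≈ bagToList b'
≃⇒bagToList-↭ {b} {b'} p = subst₂ _≈_ (toList-bag b) (toList-bag b') (≃⇒toList-↭ p)

↭⇒listToBag-≃ : ∀ {xs ys} → xs ≈ ys → listToBag xs ≃ listToBag ys
↭⇒listToBag-≃ (Hom.refl pw) = Pointwise⇒listToBag-≃ pw
  where
  Pointwise⇒listToBag-≃ : ∀ {xs ys} → PW.Pointwise _≃_ xs ys → listToBag xs ≃ listToBag ys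
  Pointwise⇒listToBag-≃ PW.[] = ≃-refl
  Pointwise⇒listToBag-≃ (p PW.∷ q) = ≃-cons p (Pointwise⇒listToBag-≃ q)
↭⇒listToBag-≃ (Hom.prep e p) = ≃-cons e (↭⇒listToBag-≃ p)
↭⇒listToBag-≃ (Hom.swap e1 e2 p) = ≃-trans (≃-cons e1 (≃-cons e2 (↭⇒listToBag-≃ p))) ≃-swap
↭⇒listToBag-≃ (Hom.trans p q) = ≃-trans (↭⇒listToBag-≃ p) (↭⇒listToBag-≃ q)

shift-var-< : ∀ {c k} → k < c → shift c (var k) ≡ var k
shift-var-< p rewrite <ᵇ-true p = refl

shift-var-≥ : ∀ {c k} → c ≤ k → shift c (var k) ≡ var (suc k)
shift-var-≥ p rewrite <ᵇ-false p = refl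

shift-shift : ∀ {s} (e : Exp s) i j → i ≤ j → shift (suc j) (shift i e) ≡ shift i (shift j e)
shift-shift (var k) i j ij with <-cmp k i
... | tri< k<i _ _ rewrite shift-var-< k<i | shift-var-< {suc j} {k} (≤-trans k<i (≤-trans ij (n≤1+n j))) | shift-var-< {j} {k} (≤-trans k<i ij) | shift-var-< k<i = refl
... | tri≈ _ refl _ rewrite shift-var-≥ {i} {k} ≤-refl with <-cmp k j
...   | tri< k<j _ _ rewrite shift-var-< {suc j} {suc k} (s≤s k<j) | shift-var-< k<j | shift-var-≥ {k} {k} ≤-refl = refl
...   | tri≈ _ refl _ rewrite shift-var-≥ {suc k} {suc k} ≤-refl | shift-var-≥ {k} {k} ≤-refl | shift-var-≥ {k} {suc k} (n≤1+n k) = refl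
...   | tri> _ _ j<k rewrite shift-var-≥ {suc j} {suc k} (s≤s (<⇒≤ j<k)) | shift-var-≥ {j} {k} (<⇒≤ j<k) | shift-var-≥ {k} {suc k} (n≤1+n k) = refl
shift-shift (var k) i j ij | tri> _ _ i<k rewrite shift-var-≥ {i} {k} (<⇒≤ i<k) with <-cmp k j
...   | tri< k<j _ _ rewrite shift-var-< {suc j} {suc k} (s≤s k<j) | shift-var-< k<j | shift-var-≥ {i} {k} (<⇒≤ i<k) = refl
...   | tri≈ _ refl _ rewrite shift-var-≥ {suc k} {suc k} ≤-refl | shift-var-≥ {k} {k} ≤-refl | shift-var-≥ {i} {suc k} (≤-trans (<⇒≤ i<k) (n≤1+n k)) = refl
...   | tri> _ _ j<k rewrite shift-var-≥ {suc j} {suc k} (s≤s (<⇒≤ j<k)) | shift-var-≥ {j} {k} (<⇒≤ j<k) | shift-var-≥ {i} {suc k} (≤-trans (<⇒≤ i<k) (n≤1+n k)) = refl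
shift-shift (lam e) i j ij = cong lam (shift-shift e (suc i) (suc j) (s≤s ij))
shift-shift (app e b) i j ij = cong₂ app (shift-shift e i j ij) (shift-shift b i j ij)
shift-shift []ᵇ i j ij = refl
shift-shift (t ∷ᵇ b) i j ij = cong₂ _∷ᵇ_ (shift-shift t i j ij) (shift-shift b i j ij)

shift-weaken : ∀ n v i → i ≤ n → shift i (weaken n v) ≡ weaken (suc n) v
shift-weaken zero v zero _ = refl
shift-weaken (suc n) v zero _ = refl
shift-weaken (suc n) v (suc i) (s≤s le) =
  trans (shift-shift (weaken n v) 0 i z≤n) (cong (shift 0) (shift-weaken n v i le))

shift-+-weaken : ∀ n c v → shift (n + c) (weaken n v) ≡ weaken n (shift c v)
shift-+-weaken zero c v = refl
shift-+-weaken (suc n) c v = trans (shift-shift (weaken n v) 0 (n + c) z≤n) (cong (shift 0) (shift-+-weaken n c v))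

shift-≃ : ∀ {s} c {e e' : Exp s} → e ≃ e' → shift c e ≃ shift c e'
shift-≃ c ≃-refl = ≃-refl
shift-≃ c (≃-sym p) = ≃-sym (shift-≃ c p)
shift-≃ c (≃-trans p q) = ≃-trans (shift-≃ c p) (shift-≃ c q)
shift-≃ c (≃-lam p) = ≃-lam (shift-≃ (suc c) p)
shift-≃ c (≃-app p q) = ≃-app (shift-≃ c p) (shift-≃ c q)
shift-≃ c (≃-cons p q) = ≃-cons (shift-≃ c p) (shift-≃ c q)
shift-≃ c ≃-swap = ≃-swap

weaken-≃ : ∀ n {e e'} → e ≃ e' → weaken n e ≃ weaken n e'
weaken-≃ zero p = p
weaken-≃ (suc n) p = shift-≃ 0 (weaken-≃ n p)

bagToList-shift : ∀ c b → bagToList (shift c b) ≡ map (shift c) (bagToList b)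
bagToList-shift c []ᵇ = refl
bagToList-shift c (t ∷ᵇ b) = cong (shift c t ∷_) (bagToList-shift c b)

-- Structural multilinear substitution

prod : ∀ {s1 s2 s3} → (Exp s1 → Exp s2 → Exp s3) → Sum s1 → Sum s2 → Sum s3
prod f X Y = concatMap (λ x → map (f x) Y) X

unshiftVar : ℕ → ℕ → Term
unshiftVar d k = if k <ᵇ d then var k else var (pred k)

-- msub d e L is e⟨L/x⟩ for x the index d: the arguments L are distributed over the
-- immediate subterms along all splittings of L, and a variable consumes exactly one.
msub : ∀ {s} → ℕ → Exp s → List Term → Sum s
msub d (var k) [] = if k ≡ᵇ d then [] else unshiftVar d k ∷ []
msub d (var k) (v ∷ []) = if k ≡ᵇ d then weaken d v ∷ [] else []
msub d (var k) (_ ∷ _ ∷ _) = []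
msub d (lam e) L = map lam (msub (suc d) e L)
msub d (app e c) L = Σsplits L (λ X Y → prod app (msub d e X) (msub d c Y))
msub d []ᵇ [] = []ᵇ ∷ []
msub d []ᵇ (_ ∷ _) = []
msub d (t ∷ᵇ b) L = Σsplits L (λ X Y → prod _∷ᵇ_ (msub d t X) (msub d b Y))

≃-Congruent₂ : ∀ {s1 s2 s3} → (Exp s1 → Exp s2 → Exp s3) → Set
≃-Congruent₂ f = ∀ {x x' y y'} → x ≃ x' → y ≃ y' → f x y ≃ f x' y'

map-≈ : ∀ {s1 s2} (f : Exp s1 → Exp s2) → (∀ {x x'} → x ≃ x' → f x ≃ f x') → ∀ {X X'} → X ≈ X' → map f X ≈ map f X'
map-≈ f fc p = map⁺ (≃-setoid _) fc p

map-≃-pointwise : ∀ {s1 s2} (f g : Exp s1 → Exp s2) → (∀ y → f y ≃ g y) → ∀ Y → map f Y ≈ map g Y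
map-≃-pointwise f g h [] = ↭-refl
map-≃-pointwise f g h (y ∷ Y) = Hom.prep (h y) (map-≃-pointwise f g h Y)

prod-cong : ∀ {s1 s2 s3} (f : Exp s1 → Exp s2 → Exp s3) → ≃-Congruent₂ f → ∀ {X X' Y Y'} → X ≈ X' → Y ≈ Y' → prod f X Y ≈ prod f X' Y'
prod-cong f fc {X} {X'} {Y} {Y'} p q =
  concatMap-Permutation _≃_ (λ x → map (f x) Y) p (λ e → map-≃-pointwise (f _) (f _) (λ y → fc e ≃-refl) Y)
  ⊚ concatMap-↭ X' (λ x → map-≈ (f x) (fc ≃-refl) q)

prod-[]ʳ : ∀ {s1 s2 s3} (f : Exp s1 → Exp s2 → Exp s3) X → prod f X [] ≡ []
prod-[]ʳ f [] = refl
prod-[]ʳ f (x ∷ X) = prod-[]ʳ f X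

fill₁ : ∀ {s} → ℕ → Exp s → List Term → Exp s
fill₁ d e o = proj₁ (fill d e o)

splitAt-length : ∀ {A : Set} (o : List A) k m → length o ≡ k + m →
  Σ[ oa ∈ List A ] Σ[ ob ∈ List A ] (o ≡ oa ++ ob × length oa ≡ k × length ob ≡ m)
splitAt-length o zero m eq = [] , o , refl , refl , eq
splitAt-length (x ∷ o) (suc k) m eq with splitAt-length o k m (suc-injective eq)
... | oa , ob , refl , la , lb = x ∷ oa , ob , refl , cong suc la , lb

fill-prefix-result : ∀ {s} d (e : Exp s) o → length o ≡ occ d e → Σ[ x ∈ Exp s ] (∀ r → fill d e (o ++ r) ≡ (x , r))
fill-prefix-result d (var k) [] eq with k ≡ᵇ d
... | true = ⊥-elim (0≢1+n eq)
... | false = (if k <ᵇ d then var k else var (pred k)) , λ r → refl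
fill-prefix-result d (var k) (v ∷ []) eq with k ≡ᵇ d
... | true = weaken d v , λ r → refl
... | false = ⊥-elim (0≢1+n (sym eq))
fill-prefix-result d (var k) (v ∷ w ∷ o) eq with k ≡ᵇ d
fill-prefix-result d (var k) (v ∷ w ∷ o) () | true
fill-prefix-result d (var k) (v ∷ w ∷ o) () | false
fill-prefix-result d (lam e) o eq with fill-prefix-result (suc d) e o eq
... | x , h = lam x , λ r → lem r
  where
  lem : ∀ r → fill d (lam e) (o ++ r) ≡ (lam x , r)
  lem r rewrite h r = refl
fill-prefix-result d (app e c) o eq with splitAt-length o (occ d e) (occ d c) eq
... | oa , ob , refl , la , lb with fill-prefix-result d e oa la | fill-prefix-result d c ob lb
... | x1 , h1 | x2 , h2 = app x1 x2 , lem
  where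
  lem : ∀ r → fill d (app e c) ((oa ++ ob) ++ r) ≡ (app x1 x2 , r)
  lem r rewrite ++-assoc-≡ oa ob r | h1 (ob ++ r) | h2 r = refl
fill-prefix-result d []ᵇ [] eq = []ᵇ , λ r → refl
fill-prefix-result d (t ∷ᵇ b) o eq with splitAt-length o (occ d t) (occ d b) eq
... | oa , ob , refl , la , lb with fill-prefix-result d t oa la | fill-prefix-result d b ob lb
... | x1 , h1 | x2 , h2 = x1 ∷ᵇ x2 , lem
  where
  lem : ∀ r → fill d (t ∷ᵇ b) ((oa ++ ob) ++ r) ≡ ((x1 ∷ᵇ x2) , r)
  lem r rewrite ++-assoc-≡ oa ob r | h1 (ob ++ r) | h2 r = refl

fill₁-prefix-result : ∀ {s} d (e : Exp s) o (eq : length o ≡ occ d e) → fill₁ d e o ≡ proj₁ (fill-prefix-result d e o eq)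
fill₁-prefix-result d e o eq with fill-prefix-result d e o eq
... | x , h = cong proj₁ (subst (λ z → fill d e z ≡ (x , [])) (++-identityʳ-≡ o) (h []))

fill-prefix : ∀ {s} d (e : Exp s) oa ob (la : length oa ≡ occ d e) → fill d e (oa ++ ob) ≡ (fill₁ d e oa , ob)
fill-prefix d e oa ob la with fill-prefix-result d e oa la | fill₁-prefix-result d e oa la
... | x , h | q rewrite q = h ob

fill-exact : ∀ {s} d (e : Exp s) o (la : length o ≡ occ d e) → fill d e o ≡ (fill₁ d e o , [])
fill-exact d e o la = subst (λ z → fill d e z ≡ (fill₁ d e o , [])) (++-identityʳ-≡ o) (fill-prefix d e o [] la)

take-length-++ : ∀ {A : Set} (oa ob : List A) → take (length oa) (oa ++ ob) ≡ oa
take-length-++ [] ob = refl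
take-length-++ (x ∷ oa) ob = cong (x ∷_) (take-length-++ oa ob)

drop-length-++ : ∀ {A : Set} (oa ob : List A) → drop (length oa) (oa ++ ob) ≡ ob
drop-length-++ [] ob = refl
drop-length-++ (x ∷ oa) ob = drop-length-++ oa ob

fill-app : ∀ d e c o → length o ≡ occ d e + occ d c →
  fill₁ d (app e c) o ≡ app (fill₁ d e (take (occ d e) o)) (fill₁ d c (drop (occ d e) o))
fill-app d e c o eq with splitAt-length o (occ d e) (occ d c) eq
... | oa , ob , refl , la , lb rewrite sym la | take-length-++ oa ob | drop-length-++ oa ob | la | fill-prefix d e oa ob la
        | fill-exact d c ob lb = refl

fill-∷ᵇ : ∀ d t b o → length o ≡ occ d t + occ d b →
  fill₁ d (t ∷ᵇ b) o ≡ (fill₁ d t (take (occ d t) o) ∷ᵇ fill₁ d b (drop (occ d t) o))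
fill-∷ᵇ d t b o eq with splitAt-length o (occ d t) (occ d b) eq
... | oa , ob , refl , la , lb rewrite sym la | take-length-++ oa ob | drop-length-++ oa ob | la | fill-prefix d t oa ob la
        | fill-exact d b ob lb = refl

fill-lam : ∀ d e o → fill₁ d (lam e) o ≡ lam (fill₁ (suc d) e o)
fill-lam d e o with fill (suc d) e o
... | x , r = refl

All-concatMap : ∀ {A B : Set} {P : B → Set} (f : A → List B) {xs} → All (λ x → All P (f x)) xs → All P (concatMap f xs)
All-concatMap f [] = []
All-concatMap f (p ∷ ps) = All.++⁺ p (All-concatMap f ps)

splits-length : ∀ {A : Set} (L : List A) → All (λ (p : List A × List A) → length (proj₁ p) + length (proj₂ p) ≡ length L) (splits L)
splits-length [] = refl ∷ []
splits-length (x ∷ xs) = All.++⁺ (All.map⁺ (All.map (cong suc) (splits-length xs)))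
                             (All.map⁺ (All.map (λ {p} e → trans (+-suc (length (proj₁ p)) (length (proj₂ p))) (cong suc e)) (splits-length xs)))

insertions-length : ∀ {A : Set} (x : A) o → All (λ w → length w ≡ suc (length o)) (insertions x o)
insertions-length x [] = refl ∷ []
insertions-length x (z ∷ zs) = refl ∷ All.map⁺ (All.map (cong suc) (insertions-length x zs))

orderings-length : ∀ {A : Set} (L : List A) → All (λ o → length o ≡ length L) (orderings L)
orderings-length [] = refl ∷ []
orderings-length (x ∷ xs) = All-concatMap (insertions x) (All.map (λ {o} e → All.map (λ e' → trans e' (cong suc e)) (insertions-length x o)) (orderings-length xs))

map-as-concatMap : ∀ {A B : Set} (f : A → B) xs → map f xs ≡ concatMap (λ x → f x ∷ []) xs
map-as-concatMap f [] = refl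
map-as-concatMap f (x ∷ xs) = cong (f x ∷_) (map-as-concatMap f xs)

prod-map : ∀ {s1 s2 s3} (h : Exp s1 → Exp s2 → Exp s3) {A B : Set} (f : A → Exp s1) (g : B → Exp s2) X Y →
  prod h (map f X) (map g Y) ≡ concatMap (λ a → concatMap (λ b → h (f a) (g b) ∷ []) Y) X
prod-map h f g [] Y = refl
prod-map h f g (x ∷ X) Y = cong₂ _++_ (trans (sym (map-∘ Y)) (map-as-concatMap (λ b → h (f x) (g b)) Y)) (prod-map h f g X Y)

concatMap-All-[] : ∀ {A B : Set} (f : A → List B) {xs} → All (λ x → f x ≡ []) xs → concatMap f xs ≡ []
concatMap-All-[] f [] = refl
concatMap-All-[] f (p ∷ ps) rewrite p = concatMap-All-[] f ps

Σsplits-prod-mismatch : ∀ {s₁ s₂ s₃} (f : Exp s₁ → Exp s₂ → Exp s₃) d (e : Exp s₁) (c : Exp s₂) →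
  (∀ X → length X ≢ occ d e → msub d e X ≡ []) → (∀ Y → length Y ≢ occ d c → msub d c Y ≡ []) →
  ∀ L → length L ≢ occ d e + occ d c → Σsplits L (λ X Y → prod f (msub d e X) (msub d c Y)) ≡ []
Σsplits-prod-mismatch f d e c mismatchₑ mismatch꜀ L ne = concatMap-All-[] _ (All.map (λ {p} → go p) (splits-length L))
  where
  go : ∀ p → length (proj₁ p) + length (proj₂ p) ≡ length L → prod f (msub d e (proj₁ p)) (msub d c (proj₂ p)) ≡ []
  go (X , Y) eq with length X ≟ occ d e
  ... | no nx rewrite mismatchₑ X nx = refl
  ... | yes ex rewrite mismatch꜀ Y (λ ey → ne (trans (sym eq) (cong₂ _+_ ex ey))) = prod-[]ʳ f (msub d e X)

msub-arity-mismatch : ∀ {s} d (e : Exp s) L → length L ≢ occ d e → msub d e L ≡ []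
msub-arity-mismatch d (var k) [] ne with k ≡ᵇ d
... | true = refl
... | false = ⊥-elim (ne refl)
msub-arity-mismatch d (var k) (v ∷ []) ne with k ≡ᵇ d
... | true = ⊥-elim (ne refl)
... | false = refl
msub-arity-mismatch d (var k) (v ∷ w ∷ L) ne = refl
msub-arity-mismatch d (lam e) L ne rewrite msub-arity-mismatch (suc d) e L ne = refl
msub-arity-mismatch d (app e c) =
  Σsplits-prod-mismatch app d e c (msub-arity-mismatch d e) (msub-arity-mismatch d c)
msub-arity-mismatch d []ᵇ [] ne = ⊥-elim (ne refl)
msub-arity-mismatch d []ᵇ (x ∷ L) ne = refl
msub-arity-mismatch d (t ∷ᵇ b) =
  Σsplits-prod-mismatch _∷ᵇ_ d t b (msub-arity-mismatch d t) (msub-arity-mismatch d b)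

ifLength-yes : ∀ {s} {A : Set} (X : List A) k (W : Sum s) → length X ≡ k → ifLength k X W ≡ W
ifLength-yes X k W refl rewrite ≡ᵇ-refl (length X) = refl

ifLength-no : ∀ {s} {A : Set} (X : List A) k (W : Sum s) → length X ≢ k → ifLength k X W ≡ []
ifLength-no X k W ne rewrite ≡ᵇ-false ne = refl

fill-orderings≈Σsplits : ∀ {s₁ s₂ s₃} (f : Exp s₁ → Exp s₂ → Exp s₃) → ≃-Congruent₂ f → ∀ d (e : Exp s₁) (c : Exp s₂) →
  (∀ X → length X ≡ occ d e → map (fill₁ d e) (orderings X) ≈ msub d e X) →
  (∀ Y → length Y ≡ occ d c → map (fill₁ d c) (orderings Y) ≈ msub d c Y) →
  ∀ L → length L ≡ occ d e + occ d c →
  map (λ o → f (fill₁ d e (take (occ d e) o)) (fill₁ d c (drop (occ d e) o))) (orderings L)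
    ≈ Σsplits L (λ X Y → prod f (msub d e X) (msub d c Y))
fill-orderings≈Σsplits f fc d e c fillₑ fill꜀ L eq =
  ↭-reflexive (map-as-concatMap _ (orderings L))
  ⊚ Σorderings-take-drop (occ d e) L (subst (occ d e ≤_) (sym eq) (m≤m+n (occ d e) (occ d c))) F
  ⊚ concatMap-↭-All (All.map (λ {p} → go p) (splits-length L))
  where
  F : List Term → List Term → Sum _
  F a b = f (fill₁ d e a) (fill₁ d c b) ∷ []
  go : ∀ p → length (proj₁ p) + length (proj₂ p) ≡ length L →
    uncurry (λ X Y → ifLength (occ d e) X (concatMap (λ a → concatMap (F a) (orderings Y)) (orderings X))) p
    ↭ uncurry (λ X Y → prod f (msub d e X) (msub d c Y)) p
  go (X , Y) el with length X ≟ occ d e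
  ... | yes ex rewrite ifLength-yes X (occ d e) (concatMap (λ a → concatMap (F a) (orderings Y)) (orderings X)) ex =
    ↭-reflexive (sym (prod-map f (fill₁ d e) (fill₁ d c) (orderings X) (orderings Y)))
    ⊚ prod-cong f fc (fillₑ X ex) (fill꜀ Y (+-cancelˡ-≡ (occ d e) _ _ (trans (cong (_+ length Y) (sym ex)) (trans el eq))))
  ... | no nx rewrite ifLength-no X (occ d e) (concatMap (λ a → concatMap (F a) (orderings Y)) (orderings X)) nx
                    | msub-arity-mismatch d e X nx = ↭-refl

fill-orderings≈msub : ∀ {s} d (e : Exp s) L → length L ≡ occ d e → map (fill₁ d e) (orderings L) ≈ msub d e L
fill-orderings≈msub d (var k) [] eq with k ≡ᵇ d
... | true = ⊥-elim (0≢1+n eq)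
... | false = ↭-refl
fill-orderings≈msub d (var k) (v ∷ []) eq with k ≡ᵇ d
... | true = ↭-refl
... | false = ⊥-elim (0≢1+n (sym eq))
fill-orderings≈msub d (var k) (v ∷ w ∷ L) eq with k ≡ᵇ d
fill-orderings≈msub d (var k) (v ∷ w ∷ L) () | true
fill-orderings≈msub d (var k) (v ∷ w ∷ L) () | false
fill-orderings≈msub d (lam e) L eq =
  ↭-reflexive (map-cong (fill-lam d e) (orderings L))
  ⊚ ↭-reflexive (map-∘ (orderings L))
  ⊚ map-≈ lam ≃-lam (fill-orderings≈msub (suc d) e L eq)
fill-orderings≈msub d (app e c) L eq =
  ↭-reflexive (map-cong-local (All.map (λ {o} eo → fill-app d e c o (trans eo eq)) (orderings-length L)))
  ⊚ fill-orderings≈Σsplits app ≃-app d e c (fill-orderings≈msub d e) (fill-orderings≈msub d c) L eq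
fill-orderings≈msub d []ᵇ [] eq = ↭-refl
fill-orderings≈msub d (t ∷ᵇ b) L eq =
  ↭-reflexive (map-cong-local (All.map (λ {o} eo → fill-∷ᵇ d t b o (trans eo eq)) (orderings-length L)))
  ⊚ fill-orderings≈Σsplits _∷ᵇ_ ≃-cons d t b (fill-orderings≈msub d t) (fill-orderings≈msub d b) L eq

msubst≈msub : ∀ {s} (u : Exp s) b → msubst u b ≈ msub 0 u (bagToList b)
msubst≈msub u b with length (bagToList b) ≟ occ 0 u
... | yes eq rewrite eq | ≡ᵇ-refl (occ 0 u) = fill-orderings≈msub 0 u (bagToList b) eq
... | no ne rewrite ≡ᵇ-false ne | msub-arity-mismatch 0 u (bagToList b) ne = ↭-refl

prod-concatMapʳ : ∀ {s1 s2 s3} (f : Exp s1 → Exp s2 → Exp s3) {I : Set} A (g : I → Sum s2) I' →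
  prod f A (concatMap g I') ≈ concatMap (λ i → prod f A (g i)) I'
prod-concatMapʳ f A g I' =
  concatMap-↭ A (λ a → ↭-reflexive (map-concatMap (f a) g I'))
  ⊚ concatMap-comm (λ a i → map (f a) (g i)) A I'

prod-concatMapˡ : ∀ {s1 s2 s3} (f : Exp s1 → Exp s2 → Exp s3) {I : Set} (g : I → Sum s1) I' B →
  prod f (concatMap g I') B ≡ concatMap (λ i → prod f (g i) B) I'
prod-concatMapˡ f g [] B = refl
prod-concatMapˡ f g (i ∷ I') B = trans (concatMap-++ (λ x → map (f x) B) (g i) (concatMap g I')) (cong (prod f (g i) B ++_) (prod-concatMapˡ f g I' B))

prod-∷ᵇ-swap : ∀ V U B → prod _∷ᵇ_ V (prod _∷ᵇ_ U B) ≈ prod _∷ᵇ_ U (prod _∷ᵇ_ V B)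
prod-∷ᵇ-swap V U B =
  prod-concatMapʳ _∷ᵇ_ V (λ u → map (u ∷ᵇ_) B) U
  ⊚ concatMap-↭ U (λ u → ↭-reflexive (V-outer u))
  ⊚ ↭-sym (concatMap-comm (λ v u → map (λ b → v ∷ᵇ u ∷ᵇ b) B) V U)
  ⊚ concatMap-↭ V (λ v → concatMap-↭ U (λ u → map-≃-pointwise (λ b → v ∷ᵇ u ∷ᵇ b) (λ b → u ∷ᵇ v ∷ᵇ b) (λ b → ≃-swap) B))
  ⊚ concatMap-↭ V (λ v → ↭-reflexive (sym (U-outer v)))
  ⊚ ↭-sym (prod-concatMapʳ _∷ᵇ_ U (λ v → map (v ∷ᵇ_) B) V)
  where
  V-outer : ∀ u → prod _∷ᵇ_ V (map (u ∷ᵇ_) B) ≡ concatMap (λ v → map (λ b → v ∷ᵇ u ∷ᵇ b) B) V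
  V-outer u = concatMap-cong (λ v → sym (map-∘ B)) V
  U-outer : ∀ v → prod _∷ᵇ_ U (map (v ∷ᵇ_) B) ≡ concatMap (λ u → map (λ b → u ∷ᵇ v ∷ᵇ b) B) U
  U-outer v = concatMap-cong (λ u → sym (map-∘ B)) U

[]-↭-inv : ∀ {s} {ys : Sum s} → [] ≈ ys → ys ≡ []
[]-↭-inv p with xs↭ys⇒|xs|≡|ys| p
[]-↭-inv {ys = []} p | _ = refl

[-]-↭-inv : ∀ {s} {x : Exp s} {ys} → (x ∷ []) ≈ ys → Σ[ y ∈ Exp s ] (ys ≡ y ∷ [] × x ≃ y)
[-]-↭-inv (Hom.refl (e PW.∷ PW.[])) = _ , refl , e
[-]-↭-inv (Hom.prep e p) rewrite []-↭-inv p = _ , refl , e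
[-]-↭-inv (Hom.trans p q) with [-]-↭-inv p
... | y , refl , e with [-]-↭-inv q
... | z , refl , e' = z , refl , ≃-trans e e'

msub-↭ : ∀ {s} d (e : Exp s) {L L'} → L ≈ L' → msub d e L ≈ msub d e L'
msub-↭ d (var k) {[]} p rewrite []-↭-inv p = ↭-refl
msub-↭ d (var k) {v ∷ []} p with [-]-↭-inv p
... | v' , refl , e with k ≡ᵇ d
... | true = Hom.prep (weaken-≃ d e) ↭-refl
... | false = ↭-refl
msub-↭ d (var k) {v ∷ w ∷ L} {L'} p with xs↭ys⇒|xs|≡|ys| p
msub-↭ d (var k) {v ∷ w ∷ L} {_ ∷ _ ∷ _} p | _ = ↭-refl
msub-↭ d (lam e) p = map-≈ lam ≃-lam (msub-↭ (suc d) e p)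
msub-↭ d (app e c) {L} {L'} p = Σsplits-Permutation _≃_ ≃-refl p (λ X Y → prod app (msub d e X) (msub d c Y))
  (λ q r → prod-cong app ≃-app (msub-↭ d e q) (msub-↭ d c r))
msub-↭ d []ᵇ {[]} p rewrite []-↭-inv p = ↭-refl
msub-↭ d []ᵇ {x ∷ L} {L'} p with xs↭ys⇒|xs|≡|ys| p
msub-↭ d []ᵇ {x ∷ L} {_ ∷ _} p | _ = ↭-refl
msub-↭ d (t ∷ᵇ b) {L} {L'} p = Σsplits-Permutation _≃_ ≃-refl p (λ X Y → prod _∷ᵇ_ (msub d t X) (msub d b Y))
  (λ q r → prod-cong _∷ᵇ_ ≃-cons (msub-↭ d t q) (msub-↭ d b r))

msub-≃ : ∀ {s} {e e' : Exp s} → e ≃ e' → ∀ d L → msub d e L ≈ msub d e' L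
msub-≃ ≃-refl d L = ↭-refl
msub-≃ (≃-sym p) d L = ↭-sym (msub-≃ p d L)
msub-≃ (≃-trans p q) d L = msub-≃ p d L ⊚ msub-≃ q d L
msub-≃ (≃-lam p) d L = map-≈ lam ≃-lam (msub-≃ p (suc d) L)
msub-≃ (≃-app p q) d L = Σsplits-↭ L (λ X Y → prod-cong app ≃-app (msub-≃ p d X) (msub-≃ q d Y))
msub-≃ (≃-cons p q) d L = Σsplits-↭ L (λ X Y → prod-cong _∷ᵇ_ ≃-cons (msub-≃ p d X) (msub-≃ q d Y))
msub-≃ (≃-swap {u} {v} {b}) d L =
  Σsplits-↭ L (λ X Y → prod-concatMapʳ _∷ᵇ_ (msub d u X) (uncurry (λ Y1 Y2 → prod _∷ᵇ_ (msub d v Y1) (msub d b Y2))) (splits Y))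
  ⊚ Σsplits-exchange L (λ X Y1 Y2 → prod _∷ᵇ_ (msub d u X) (prod _∷ᵇ_ (msub d v Y1) (msub d b Y2)))
  ⊚ Σsplits-↭ L (λ X Y → Σsplits-↭ Y (λ Y1 Y2 → prod-∷ᵇ-swap (msub d u Y1) (msub d v X) (msub d b Y2)))
  ⊚ ↭-sym (Σsplits-↭ L (λ X Y → prod-concatMapʳ _∷ᵇ_ (msub d v X) (uncurry (λ Y1 Y2 → prod _∷ᵇ_ (msub d u Y1) (msub d b Y2))) (splits Y)))

msubst-cong : ∀ {s} {u u' : Exp s} {b b'} → u ≃ u' → b ≃ b' → msubst u b ≈ msubst u' b'
msubst-cong {s} {u} {u'} {b} {b'} p q =
  msubst≈msub u b ⊚ msub-↭ 0 u (≃⇒bagToList-↭ q) ⊚ msub-≃ p 0 (bagToList b') ⊚ ↭-sym (msubst≈msub u' b')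

ifEmpty : ∀ {A B : Set} → List A → List B → List B
ifEmpty [] X = X
ifEmpty (_ ∷ _) X = []

ifEmpty-[] : ∀ {X : Set} {s} (B : List X) → ifEmpty {B = Exp s} B [] ≡ []
ifEmpty-[] [] = refl
ifEmpty-[] (_ ∷ _) = refl

msub-var-≢ : ∀ {d k} L → k ≢ d → msub d (var k) L ≡ ifEmpty L (unshiftVar d k ∷ [])
msub-var-≢ {d} {k} [] ne rewrite ≡ᵇ-false ne = refl
msub-var-≢ {d} {k} (v ∷ []) ne rewrite ≡ᵇ-false ne = refl
msub-var-≢ (v ∷ w ∷ L) ne = refl

msub-var-≡-single : ∀ {d} v → msub d (var d) (v ∷ []) ≡ weaken d v ∷ []
msub-var-≡-single {d} v rewrite ≡ᵇ-refl d = refl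

msub-var-≡-[] : ∀ {d} → msub d (var d) [] ≡ []
msub-var-≡-[] {d} rewrite ≡ᵇ-refl d = refl

unshiftVar-< : ∀ {d k} → k < d → unshiftVar d k ≡ var k
unshiftVar-< p rewrite <ᵇ-true p = refl

unshiftVar-> : ∀ {d k} → d < k → unshiftVar d k ≡ var (pred k)
unshiftVar-> p rewrite <ᵇ-false (<⇒≤ p) = refl

shiftIndex : ℕ → ℕ → ℕ
shiftIndex c k = if k <ᵇ c then k else suc k

shift-var : ∀ c k → shift c (var k) ≡ var (shiftIndex c k)
shift-var c k with k <ᵇ c
... | true = refl
... | false = refl

map-prod : ∀ {s1 s2 s3} (f : Exp s1 → Exp s2 → Exp s3) (h : Exp s3 → Exp s3) (h1 : Exp s1 → Exp s1) (h2 : Exp s2 → Exp s2) →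
  (∀ x y → h (f x y) ≡ f (h1 x) (h2 y)) → ∀ A B → map h (prod f A B) ≡ prod f (map h1 A) (map h2 B)
map-prod f h h1 h2 eq [] B = refl
map-prod f h h1 h2 eq (x ∷ A) B =
  trans (map-++ h (map (f x) B) (prod f A B))
        (cong₂ _++_ (trans (sym (map-∘ B)) (trans (map-cong (λ y → eq x y) B) (map-∘ B)))
                    (map-prod f h h1 h2 eq A B))

Σsplits-map : ∀ {s} {B : Set} (g : B → B) (L : List B) (K : List B → List B → Sum s) →
  Σsplits (map g L) K ≈ Σsplits L (λ X Y → K (map g X) (map g Y))
Σsplits-map g [] K = ↭-refl
Σsplits-map g (x ∷ L) K = ↭-reflexive (Σsplits-∷ (g x) (map g L) K)
  ⊚ ++⁺ (Σsplits-map g L (λ X Y → K (g x ∷ X) Y)) (Σsplits-map g L (λ X Y → K X (g x ∷ Y)))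
  ⊚ ↭-reflexive (sym (Σsplits-∷ x L (λ X Y → K (map g X) (map g Y))))

m<m+suc-n : ∀ k c → k < k + suc c
m<m+suc-n k c = ≤-trans (s≤s (m≤m+n k c)) (≤-reflexive (sym (+-suc k c)))

≡⇒≃ : ∀ {s} {x y : Exp s} → x ≡ y → x ≃ y
≡⇒≃ refl = ≃-refl

-- Parallel reduction of sums

-- →rₛ without its mandatory reducing summand.
Par : ∀ {s} → Sum s → Sum s → Set
Par {s} ε ε' = Σ[ ps ∈ List (Exp s × Sum s) ] (All OptStep ps × ε ≈ map proj₁ ps × ε' ≈ concatMap proj₂ ps)

Par-resp : ∀ {s} {a a' b b' : Sum s} → a' ≈ a → Par a b → b ≈ b' → Par a' b'
Par-resp p (ps , A , q , r) s = ps , A , (p ⊚ q) , (↭-sym s ⊚ r)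

Par-[] : ∀ {s} → Par {s} [] []
Par-[] = [] , [] , ↭-refl , ↭-refl

Par-++ : ∀ {s} {a a' b b' : Sum s} → Par a a' → Par b b' → Par (a ++ b) (a' ++ b')
Par-++ (ps , A , p , q) (ps' , A' , p' , q') =
  ps ++ ps' , All.++⁺ A A' , (++⁺ p p' ⊚ ↭-reflexive (sym (map-++ proj₁ ps ps'))) ,
  (++⁺ q q' ⊚ ↭-reflexive (sym (concatMap-++ proj₂ ps ps')))

Par-refl : ∀ {s} (a : Sum s) → Par a a
Par-refl [] = Par-[]
Par-refl (e ∷ a) = Par-++ {a = e ∷ []} ((e , e ∷ []) ∷ [] , inj₂ refl ∷ [] , ↭-refl , ↭-refl) (Par-refl a)

Par-step : ∀ {s} {e : Exp s} {σ} → e →r σ → Par (e ∷ []) σ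
Par-step {e = e} {σ} r = (e , σ) ∷ [] , inj₁ r ∷ [] , ↭-refl , ↭-sym (++-identityʳ σ)

Par-concatMap : ∀ {s} {I : Set} (f g : I → Sum s) (is : List I) → (∀ i → Par (f i) (g i)) → Par (concatMap f is) (concatMap g is)
Par-concatMap f g [] h = Par-[]
Par-concatMap f g (i ∷ is) h = Par-++ (h i) (Par-concatMap f g is h)

Par-concatMap-All : ∀ {s} {I : Set} (f g : I → Sum s) {is : List I} → All (λ i → Par (f i) (g i)) is → Par (concatMap f is) (concatMap g is)
Par-concatMap-All f g [] = Par-[]
Par-concatMap-All f g (h ∷ hs) = Par-++ h (Par-concatMap-All f g hs)

module ParMap {s s'} (C : Exp s → Exp s') (Cc : ∀ {x x'} → x ≃ x' → C x ≃ C x')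
            (lift : ∀ {e σ} → e →r σ → Σ[ σ' ∈ Sum s' ] (C e →r σ' × σ' ≈ map C σ)) where
  Par-map : ∀ {a b} → Par a b → Par (map C a) (map C b)
  Par-map {a} {b} (ps , A , p , q) =
    Par-resp (map-≈ C Cc p ⊚ ↭-reflexive (trans (sym (map-∘ ps)) (map-as-concatMap (λ x → C (proj₁ x)) ps)))
      (Par-concatMap-All (λ x → C (proj₁ x) ∷ []) (λ x → map C (proj₂ x)) (All.map step A))
      (↭-sym (map-≈ C Cc q ⊚ ↭-reflexive (map-concatMap C proj₂ ps)))
    where
    step : ∀ {x} → OptStep x → Par (C (proj₁ x) ∷ []) (map C (proj₂ x))
    step (inj₁ r) with lift r
    ... | σ' , r' , e = Par-resp ↭-refl (Par-step r') e
    step (inj₂ refl) = Par-refl _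

module ParProdˡ {s1 s2 s3} (f : Exp s1 → Exp s2 → Exp s3) (fc : ≃-Congruent₂ f)
             (liftL : ∀ {x σ y} → x →r σ → Σ[ ρ ∈ Sum s3 ] (f x y →r ρ × ρ ≈ map (λ x' → f x' y) σ)) where
  Par-prodˡ : ∀ {A A'} → Par A A' → ∀ B → Par (prod f A B) (prod f A' B)
  Par-prodˡ {A} {A'} (ps , AO , p , q) B =
    Par-resp (prod-cong f fc p ↭-refl ⊚ ↭-reflexive (concatMap-map (λ x → map (f x) B) proj₁ ps))
      (Par-concatMap-All (λ x → map (f (proj₁ x)) B) (λ x → prod f (proj₂ x) B) (All.map step AO))
      (↭-sym (prod-cong f fc q ↭-refl ⊚ ↭-reflexive (prod-concatMapˡ f proj₂ ps B)))
    where
    step : ∀ {x} → OptStep x → Par (map (f (proj₁ x)) B) (prod f (proj₂ x) B)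
    step (inj₂ refl) = Par-resp ↭-refl (Par-refl _) (↭-sym (++-identityʳ _))
    step {e , σ} (inj₁ r) =
      Par-resp (↭-reflexive (map-as-concatMap (f e) B))
        (Par-concatMap (λ y → f e y ∷ []) (λ y → map (λ x' → f x' y) σ) B st)
        (concatMap-↭ B (λ y → ↭-reflexive (map-as-concatMap (λ x' → f x' y) σ))
         ⊚ concatMap-comm (λ y x' → f x' y ∷ []) B σ
         ⊚ concatMap-↭ σ (λ x' → ↭-reflexive (sym (map-as-concatMap (f x') B))))
      where
      st : ∀ y → Par (f e y ∷ []) (map (λ x' → f x' y) σ)
      st y with liftL {y = y} r
      ... | ρ , r' , eq = Par-resp ↭-refl (Par-step r') eq

module ParProdʳ {s1 s2 s3} (f : Exp s1 → Exp s2 → Exp s3) (fc : ≃-Congruent₂ f)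
             (liftR : ∀ {x y τ} → y →r τ → Σ[ ρ ∈ Sum s3 ] (f x y →r ρ × ρ ≈ map (f x) τ)) where
  Par-prodʳ : ∀ {B B'} → Par B B' → ∀ A → Par (prod f A B) (prod f A B')
  Par-prodʳ P A = Par-concatMap (λ x → map (f x) _) (λ x → map (f x) _) A (λ x → ParMap.Par-map (f x) (fc ≃-refl) liftR P)

app-stepˡ : ∀ {x σ y} → x →r σ → Σ[ ρ ∈ Sum tm ] (app x y →r ρ × ρ ≈ map (λ x' → app x' y) σ)
app-stepˡ r = _ , ξ-appˡ r , ↭-refl

app-stepʳ : ∀ {x y τ} → y →r τ → Σ[ ρ ∈ Sum tm ] (app x y →r ρ × ρ ≈ map (app x) τ)
app-stepʳ r = _ , ξ-appʳ r , ↭-refl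

∷ᵇ-stepˡ : ∀ {x σ y} → x →r σ → Σ[ ρ ∈ Sum bg ] ((x ∷ᵇ y) →r ρ × ρ ≈ map (λ x' → x' ∷ᵇ y) σ)
∷ᵇ-stepˡ r = _ , ξ-bag ≃-refl r , ↭-refl

∷ᵇ-stepʳ : ∀ {x y τ} → y →r τ → Σ[ ρ ∈ Sum bg ] ((x ∷ᵇ y) →r ρ × ρ ≈ map (x ∷ᵇ_) τ)
∷ᵇ-stepʳ {x} (ξ-bag {t = t} {σ = σ} q r) =
  _ , ξ-bag (≃-trans (≃-cons ≃-refl q) ≃-swap) r ,
  (map-≃-pointwise (_∷ᵇ (x ∷ᵇ t)) (λ u → x ∷ᵇ u ∷ᵇ t) (λ u → ≃-swap) σ ⊚ ↭-reflexive (map-∘ σ))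

lam-step : ∀ {e σ} → e →r σ → Σ[ σ' ∈ Sum tm ] (lam e →r σ' × σ' ≈ map lam σ)
lam-step r = _ , ξ-lam r , ↭-refl

open ParProdˡ app ≃-app app-stepˡ public renaming (Par-prodˡ to Par-appˡ)
open ParProdʳ app ≃-app app-stepʳ public renaming (Par-prodʳ to Par-appʳ)
open ParProdˡ _∷ᵇ_ ≃-cons ∷ᵇ-stepˡ public renaming (Par-prodˡ to Par-∷ᵇˡ)
open ParProdʳ _∷ᵇ_ ≃-cons ∷ᵇ-stepʳ public renaming (Par-prodʳ to Par-∷ᵇʳ)
open ParMap lam ≃-lam lam-step public renaming (Par-map to Par-lam)

→r-bag-≃ : ∀ {b b' : Bag} {τ} → b →r τ → b ≃ b' → b' →r τ
→r-bag-≃ (ξ-bag q r) p = ξ-bag (≃-trans (≃-sym p) q) r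

→r-≃ : ∀ {s} {e e' : Exp s} {σ} → e →r σ → e ≃ e' → Σ[ σ' ∈ Sum s ] (e' →r σ' × σ ≈ σ')
→r-≃ β p with app-≃-inv p
... | u1 , b1 , refl , q , r with lam-≃-inv q
... | u2 , refl , q' = _ , β , msubst-cong q' r
→r-≃ (ξ-lam r) p with lam-≃-inv p
... | u' , refl , q with →r-≃ r q
... | σ' , r' , eq = _ , ξ-lam r' , map-≈ lam ≃-lam eq
→r-≃ (ξ-appˡ {σ = σ} {b = b} r) p with app-≃-inv p
... | u' , b' , refl , q , q2 with →r-≃ r q
... | σ' , r' , eq = _ , ξ-appˡ r' , (map-≈ (λ x → app x b) (λ z → ≃-app z ≃-refl) eq ⊚ map-≃-pointwise _ _ (λ x → ≃-app ≃-refl q2) σ')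
→r-≃ (ξ-appʳ {u = u} {τ = τ} r) p with app-≃-inv p
... | u' , b' , refl , q , q2 = _ , ξ-appʳ (→r-bag-≃ r q2) , map-≃-pointwise _ _ (λ x → ≃-app q ≃-refl) τ
→r-≃ (ξ-bag q r) p = _ , ξ-bag (≃-trans (≃-sym p) q) r , ↭-refl

reducing-step-or-identity : ∀ {s} (ps : List (Exp s × Sum s)) → All OptStep ps →
  (concatMap proj₂ ps ≡ map proj₁ ps) ⊎
  (Σ[ ps1 ∈ List (Exp s × Sum s) ] Σ[ e ∈ Exp s ] Σ[ σ ∈ Sum s ] Σ[ ps2 ∈ List (Exp s × Sum s) ]
    (ps ≡ ps1 ++ (e , σ) ∷ ps2 × e →r σ × All OptStep (ps1 ++ ps2)))
reducing-step-or-identity [] [] = inj₁ refl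
reducing-step-or-identity ((e , σ) ∷ ps) (inj₁ r ∷ A) = inj₂ ([] , e , σ , ps , refl , r , A)
reducing-step-or-identity ((e , .(e ∷ [])) ∷ ps) (inj₂ refl ∷ A) with reducing-step-or-identity ps A
... | inj₁ eq = inj₁ (cong (e ∷_) eq)
... | inj₂ (ps1 , e' , σ , ps2 , refl , r , A') = inj₂ ((e , e ∷ []) ∷ ps1 , e' , σ , ps2 , refl , r , inj₂ refl ∷ A')

Par⇒→rₛ⁼ : ∀ {s} {ε ε' : Sum s} → Par ε ε' → ε →rₛ⁼ ε'
Par⇒→rₛ⁼ (ps , A , p , q) with reducing-step-or-identity ps A
... | inj₁ eq = inj₁ (p ⊚ ↭-reflexive (sym eq) ⊚ ↭-sym q)
... | inj₂ (ps1 , e , σ , ps2 , refl , r , A') =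
  inj₂ (sum-step e σ (ps1 ++ ps2) r A'
    (p ⊚ ↭-reflexive (map-++ proj₁ ps1 ((e , σ) ∷ ps2)) ⊚ ↭-shift (map proj₁ ps1) (map proj₁ ps2) ⊚ ↭-reflexive (cong (e ∷_) (sym (map-++ proj₁ ps1 ps2))))
    (q ⊚ ↭-reflexive (concatMap-++ proj₂ ps1 ((e , σ) ∷ ps2)) ⊚ shifts (concatMap proj₂ ps1) σ ⊚ ↭-reflexive (cong (σ ++_) (sym (concatMap-++ proj₂ ps1 ps2)))))

-- Substitution commutes with reduction

shift-msub-var : ∀ d c k L → map (shift (d + c)) (msub d (var k) L) ≈ msub d (shift (d + suc c) (var k)) (map (shift c) L)
shift-msub-var d c k L with <-cmp k d
shift-msub-var d c k (v ∷ w ∷ L) | _ rewrite shift-var (d + suc c) k = ↭-refl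
shift-msub-var d c k [] | tri< k<d _ _
  rewrite msub-var-≢ [] (<⇒≢ k<d) | unshiftVar-< k<d | shift-var-< {d + c} (≤-trans k<d (m≤m+n d c))
        | shift-var-< {d + suc c} (≤-trans k<d (m≤m+n d (suc c))) | msub-var-≢ {d} [] (<⇒≢ k<d) | unshiftVar-< k<d = ↭-refl
shift-msub-var d c k (v ∷ []) | tri< k<d _ _
  rewrite msub-var-≢ (v ∷ []) (<⇒≢ k<d) | shift-var-< {d + suc c} (≤-trans k<d (m≤m+n d (suc c))) | msub-var-≢ {d} (shift c v ∷ []) (<⇒≢ k<d) = ↭-refl
shift-msub-var d c k [] | tri≈ _ refl _
  rewrite msub-var-≡-[] {k} | shift-var-< {k + suc c} {k} (m<m+suc-n k c) | msub-var-≡-[] {k} = ↭-refl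
shift-msub-var d c k (v ∷ []) | tri≈ _ refl _
  rewrite msub-var-≡-single {k} v | shift-var-< {k + suc c} {k} (m<m+suc-n k c) | msub-var-≡-single {k} (shift c v) = Hom.prep (≡⇒≃ (shift-+-weaken k c v)) ↭-refl
shift-msub-var d c (suc k) [] | tri> _ _ d<k with <-cmp k (d + c)
... | tri< k<dc _ _
  rewrite msub-var-≢ {d} {suc k} [] (λ e → <-irrefl (sym e) d<k) | unshiftVar-> d<k | shift-var-< k<dc
        | shift-var-< {d + suc c} {suc k} (≤-trans (s≤s k<dc) (≤-reflexive (sym (+-suc d c))))
        | msub-var-≢ {d} {suc k} [] (λ e → <-irrefl (sym e) d<k) | unshiftVar-> d<k = ↭-refl
... | tri≈ _ k≡dc _
  rewrite msub-var-≢ {d} {suc k} [] (λ e → <-irrefl (sym e) d<k) | unshiftVar-> d<k | shift-var-≥ {d + c} {k} (≤-reflexive (sym k≡dc))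
        | shift-var-≥ {d + suc c} {suc k} (≤-reflexive (trans (+-suc d c) (cong suc (sym k≡dc))))
        | msub-var-≢ {d} {suc (suc k)} [] (λ e → <-irrefl (sym e) (≤-trans d<k (n≤1+n (suc k)))) | unshiftVar-> {d} {suc (suc k)} (≤-trans d<k (n≤1+n (suc k))) = ↭-refl
... | tri> _ _ dc<k
  rewrite msub-var-≢ {d} {suc k} [] (λ e → <-irrefl (sym e) d<k) | unshiftVar-> d<k | shift-var-≥ {d + c} {k} (<⇒≤ dc<k)
        | shift-var-≥ {d + suc c} {suc k} (≤-trans (≤-reflexive (+-suc d c)) (s≤s (<⇒≤ dc<k)))
        | msub-var-≢ {d} {suc (suc k)} [] (λ e → <-irrefl (sym e) (≤-trans d<k (n≤1+n (suc k)))) | unshiftVar-> {d} {suc (suc k)} (≤-trans d<k (n≤1+n (suc k))) = ↭-refl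
shift-msub-var d c (suc k) (v ∷ []) | tri> _ _ d<k
  rewrite msub-var-≢ {d} {suc k} (v ∷ []) (λ e → <-irrefl (sym e) d<k) | shift-var (d + suc c) (suc k) =
    ↭-sym (↭-reflexive (msub-var-≢ {d} (shift c v ∷ []) (ne (shiftIndex (d + suc c) (suc k)) (shv-mono (d + suc c) (suc k)))))
  where
  shv-mono : ∀ c k → k ≤ shiftIndex c k
  shv-mono c k with k <ᵇ c
  ... | true = ≤-refl
  ... | false = n≤1+n k
  ne : ∀ m → suc k ≤ m → m ≢ d
  ne m le refl = <-irrefl refl (≤-trans d<k le)
shift-Σsplits-prod : ∀ {s₁ s₂ s₃} (f : Exp s₁ → Exp s₂ → Exp s₃) → ≃-Congruent₂ f →
  ∀ d c (e : Exp s₁) (e' : Exp s₂) → (∀ x y → shift (d + c) (f x y) ≡ f (shift (d + c) x) (shift (d + c) y)) →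
  (∀ X → map (shift (d + c)) (msub d e X) ≈ msub d (shift (d + suc c) e) (map (shift c) X)) →
  (∀ Y → map (shift (d + c)) (msub d e' Y) ≈ msub d (shift (d + suc c) e') (map (shift c) Y)) →
  ∀ L → map (shift (d + c)) (Σsplits L (λ X Y → prod f (msub d e X) (msub d e' Y)))
        ≈ Σsplits (map (shift c) L) (λ X Y → prod f (msub d (shift (d + suc c) e) X) (msub d (shift (d + suc c) e') Y))
shift-Σsplits-prod f fc d c e e' shift-f shiftₑ shiftₑ' L =
  ↭-reflexive (map-concatMap (shift (d + c)) _ (splits L))
  ⊚ concatMap-↭ (splits L) (λ p → ↭-reflexive (map-prod f (shift (d + c)) (shift (d + c)) (shift (d + c)) shift-f (msub d e (proj₁ p)) (msub d e' (proj₂ p)))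
                         ⊚ prod-cong f fc (shiftₑ (proj₁ p)) (shiftₑ' (proj₂ p)))
  ⊚ ↭-sym (Σsplits-map (shift c) L (λ X Y → prod f (msub d (shift (d + suc c) e) X) (msub d (shift (d + suc c) e') Y)))

shift-msub : ∀ {s} d c (u : Exp s) L → map (shift (d + c)) (msub d u L) ≈ msub d (shift (d + suc c) u) (map (shift c) L)
shift-msub d c (var k) = shift-msub-var d c k
shift-msub d c (lam u) L =
  ↭-reflexive (trans (sym (map-∘ (msub (suc d) u L))) (map-∘ (msub (suc d) u L)))
  ⊚ map-≈ lam ≃-lam (shift-msub (suc d) c u L)
shift-msub d c (app u b) =
  shift-Σsplits-prod app ≃-app d c u b (λ x y → refl) (shift-msub d c u) (shift-msub d c b)
shift-msub d c []ᵇ [] = ↭-refl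
shift-msub d c []ᵇ (x ∷ L) = ↭-refl
shift-msub d c (t ∷ᵇ b) =
  shift-Σsplits-prod _∷ᵇ_ ≃-cons d c t b (λ x y → refl) (shift-msub d c t) (shift-msub d c b)

shift-→r : ∀ {s} {e : Exp s} {σ} → e →r σ → ∀ c → Σ[ σ' ∈ Sum s ] (shift c e →r σ' × σ' ≈ map (shift c) σ)
shift-→r (β {u} {b}) c = _ , β ,
  (msubst≈msub (shift (suc c) u) (shift c b)
   ⊚ ↭-reflexive (cong (msub 0 (shift (suc c) u)) (bagToList-shift c b))
   ⊚ ↭-sym (shift-msub 0 c u (bagToList b))
   ⊚ map-≈ (shift c) (shift-≃ c) (↭-sym (msubst≈msub u b)))
shift-→r (ξ-lam {σ = σ} r) c with shift-→r r (suc c)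
... | σ' , r' , eq = _ , ξ-lam r' , (map-≈ lam ≃-lam eq ⊚ ↭-reflexive (trans (sym (map-∘ σ)) (map-∘ σ)))
shift-→r (ξ-appˡ {σ = σ} {b = b} r) c with shift-→r r c
... | σ' , r' , eq = _ , ξ-appˡ r' , (map-≈ (λ x → app x (shift c b)) (λ z → ≃-app z ≃-refl) eq ⊚ ↭-reflexive (trans (sym (map-∘ σ)) (map-∘ σ)))
shift-→r (ξ-appʳ {u = u} {τ = τ} r) c with shift-→r r c
... | σ' , r' , eq = _ , ξ-appʳ r' , (map-≈ (app (shift c u)) (≃-app ≃-refl) eq ⊚ ↭-reflexive (trans (sym (map-∘ τ)) (map-∘ τ)))
shift-→r (ξ-bag {t = t} {σ = σ} q r) c with shift-→r r c
... | σ' , r' , eq = _ , ξ-bag (shift-≃ c q) r' , (map-≈ (_∷ᵇ shift c t) (λ z → ≃-cons z ≃-refl) eq ⊚ ↭-reflexive (trans (sym (map-∘ σ)) (map-∘ σ)))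

weaken-→r : ∀ {e : Term} {σ} → e →r σ → ∀ n → Σ[ σ' ∈ Sum tm ] (weaken n e →r σ' × σ' ≈ map (weaken n) σ)
weaken-→r {σ = σ} r zero = _ , r , ↭-reflexive (sym (map-id σ))
weaken-→r {σ = σ} r (suc n) with weaken-→r r n
... | σ1 , r1 , eq1 with shift-→r r1 0
... | σ2 , r2 , eq2 = _ , r2 , (eq2 ⊚ map-≈ (shift 0) (shift-≃ 0) eq1 ⊚ ↭-reflexive (sym (map-∘ σ)))

module _ {t : Term} {σ : Sum tm} where
  msub-arg-step-prod : ∀ {s1 s2 s3} (f : Exp s1 → Exp s2 → Exp s3)
    (PL : ∀ {A A'} → Par A A' → ∀ B → Par (prod f A B) (prod f A' B))
    (PR : ∀ {B B'} → Par B B' → ∀ A → Par (prod f A B) (prod f A B'))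
    (F : List Term → Sum s1) (G : List Term → Sum s2)
    (IHF : ∀ X → Par (F (t ∷ X)) (concatMap (λ t' → F (t' ∷ X)) σ))
    (IHG : ∀ Y → Par (G (t ∷ Y)) (concatMap (λ t' → G (t' ∷ Y)) σ)) → ∀ ys →
    Par (Σsplits (t ∷ ys) (λ X Y → prod f (F X) (G Y))) (concatMap (λ t' → Σsplits (t' ∷ ys) (λ X Y → prod f (F X) (G Y))) σ)
  msub-arg-step-prod f PL PR F G IHF IHG ys =
    Par-resp (↭-reflexive (Σsplits-∷ t ys (λ X Y → prod f (F X) (G Y))))
      (Par-++ (Par-concatMap _ (λ p → prod f (concatMap (λ t' → F (t' ∷ proj₁ p)) σ) (G (proj₂ p))) (splits ys) (λ p → PL (IHF (proj₁ p)) (G (proj₂ p))))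
              (Par-concatMap _ (λ p → prod f (F (proj₁ p)) (concatMap (λ t' → G (t' ∷ proj₂ p)) σ)) (splits ys) (λ p → PR (IHG (proj₂ p)) (F (proj₁ p)))))
      (++⁺ (concatMap-↭ (splits ys) (λ p → ↭-reflexive (prod-concatMapˡ f (λ t' → F (t' ∷ proj₁ p)) σ (G (proj₂ p))))
              ⊚ concatMap-comm (λ p t' → prod f (F (t' ∷ proj₁ p)) (G (proj₂ p))) (splits ys) σ)
             (concatMap-↭ (splits ys) (λ p → prod-concatMapʳ f (F (proj₁ p)) (λ t' → G (t' ∷ proj₂ p)) σ)
              ⊚ concatMap-comm (λ p t' → prod f (F (proj₁ p)) (G (t' ∷ proj₂ p))) (splits ys) σ)
       ⊚ ↭-sym (concatMap-++-distrib _ _ σ)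
       ⊚ concatMap-↭ σ (λ t' → ↭-reflexive (sym (Σsplits-∷ t' ys (λ X Y → prod f (F X) (G Y))))))

  msub-arg-step : t →r σ → ∀ {s} d (u : Exp s) ys → Par (msub d u (t ∷ ys)) (concatMap (λ t' → msub d u (t' ∷ ys)) σ)
  msub-arg-step r d (var k) (w ∷ ys) = Par-resp ↭-refl Par-[] (↭-reflexive (sym (concatMap-const-[] σ)))
  msub-arg-step r d (var k) [] with k ≟ d
  ... | yes refl with weaken-→r r d
  ...   | σ' , r' , eq = Par-resp (↭-reflexive (msub-var-≡-single {d} t)) (Par-step r')
                           (eq ⊚ ↭-reflexive (map-as-concatMap (weaken d) σ) ⊚ concatMap-↭ σ (λ t' → ↭-reflexive (sym (msub-var-≡-single {d} t'))))
  msub-arg-step r d (var k) [] | no ne =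
    Par-resp (↭-reflexive (msub-var-≢ (t ∷ []) ne)) Par-[] (↭-reflexive (sym (concatMap-const-[] σ)) ⊚ concatMap-↭ σ (λ t' → ↭-reflexive (sym (msub-var-≢ (t' ∷ []) ne))))
  msub-arg-step r d (lam u) ys = Par-resp ↭-refl (Par-lam (msub-arg-step r (suc d) u ys)) (↭-reflexive (map-concatMap lam _ σ))
  msub-arg-step r d (app e c) ys = msub-arg-step-prod app Par-appˡ Par-appʳ (msub d e) (msub d c) (λ X → msub-arg-step r d e X) (λ Y → msub-arg-step r d c Y) ys
  msub-arg-step r d []ᵇ ys = Par-resp ↭-refl Par-[] (↭-reflexive (sym (concatMap-const-[] σ)))
  msub-arg-step r d (x ∷ᵇ b) ys = msub-arg-step-prod _∷ᵇ_ Par-∷ᵇˡ Par-∷ᵇʳ (msub d x) (msub d b) (λ X → msub-arg-step r d x X) (λ Y → msub-arg-step r d b Y) ys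

msubs : ℕ → List Term → List Term → List (List Term)
msubs d [] B = ifEmpty B ([] ∷ [])
msubs d (c ∷ C) B = concatMap (λ p → concatMap (λ c' → map (c' ∷_) (msubs d C (proj₂ p))) (msub d c (proj₁ p))) (splits B)

msubs-length : ∀ d C B → All (λ C1 → length C1 ≡ length C) (msubs d C B)
msubs-length d [] [] = refl ∷ []
msubs-length d [] (x ∷ B) = []
msubs-length d (c ∷ C) B = All-concatMap _ (go (splits B))
  where
  go : ∀ ps → All (λ p → All (λ C1 → length C1 ≡ length (c ∷ C)) (concatMap (λ c' → map (c' ∷_) (msubs d C (proj₂ p))) (msub d c (proj₁ p)))) ps
  go [] = []
  go (p ∷ ps) = All-concatMap _ (go2 (msub d c (proj₁ p))) ∷ go ps
    where
    go2 : ∀ xs → All (λ c' → All (λ C1 → length C1 ≡ length (c ∷ C)) (map (c' ∷_) (msubs d C (proj₂ p)))) xs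
    go2 [] = []
    go2 (x ∷ xs) = All.map⁺ (All.map (cong suc) (msubs-length d C (proj₂ p))) ∷ go2 xs

msubs-bag : ∀ d b B → map bagToList (msub d b B) ≡ msubs d (bagToList b) B
msubs-bag d []ᵇ [] = refl
msubs-bag d []ᵇ (x ∷ B) = refl
msubs-bag d (t ∷ᵇ b) B =
  trans (map-concatMap bagToList _ (splits B))
        (concatMap-cong (λ p → go (msub d t (proj₁ p)) (proj₂ p)) (splits B))
  where
  go : ∀ X Y → map bagToList (prod _∷ᵇ_ X (msub d b Y)) ≡ concatMap (λ c' → map (c' ∷_) (msubs d (bagToList b) Y)) X
  go [] Y = refl
  go (x ∷ X) Y = trans (map-++ bagToList (map (x ∷ᵇ_) (msub d b Y)) (prod _∷ᵇ_ X (msub d b Y)))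
    (cong₂ _++_ (trans (sym (map-∘ (msub d b Y))) (trans (map-∘ (msub d b Y)) (cong (map (x ∷_)) (msubs-bag d b Y)))) (go X Y))

module _ {s : Sort} where
  Σsplits-ifEmptyˡ : ∀ (L : List Term) (H : List Term → Sum s) → Σsplits L (λ A B → ifEmpty A (H B)) ≈ H L
  Σsplits-ifEmptyˡ [] H = ++-identityʳ (H [])
  Σsplits-ifEmptyˡ (x ∷ xs) H = ↭-reflexive (Σsplits-∷ x xs (λ A B → ifEmpty A (H B)))
    ⊚ ↭-reflexive (cong (_++ Σsplits xs (λ A B → ifEmpty A (H (x ∷ B)))) (concatMap-const-[] (splits xs)))
    ⊚ Σsplits-ifEmptyˡ xs (λ B → H (x ∷ B))

  Σsplits-ifEmptyʳ : ∀ (L : List Term) (H : List Term → Sum s) → Σsplits L (λ A B → ifEmpty B (H A)) ≈ H L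
  Σsplits-ifEmptyʳ L H = Σsplits-swap L (λ A B → ifEmpty B (H A)) ⊚ Σsplits-ifEmptyˡ L H

  concatMap-ifEmpty : ∀ {A X : Set} (f : X → Sum s) (B : List A) (x : X) → concatMap f (ifEmpty B (x ∷ [])) ≡ ifEmpty B (f x ++ [])
  concatMap-ifEmpty f [] x = refl
  concatMap-ifEmpty f (_ ∷ _) x = refl

occ-shift : ∀ {s} j (w : Exp s) → occ j (shift j w) ≡ 0
occ-shift j (var k) with <-cmp k j
... | tri< k<j _ _ rewrite shift-var-< k<j | ≡ᵇ-false (<⇒≢ k<j) = refl
... | tri≈ _ refl _ rewrite shift-var-≥ {k} {k} ≤-refl | ≡ᵇ-false {suc k} {k} (λ e → <-irrefl (sym e) ≤-refl) = refl
... | tri> _ _ j<k rewrite shift-var-≥ (<⇒≤ j<k) | ≡ᵇ-false {suc k} {j} (λ e → <-irrefl (sym e) (≤-trans j<k (n≤1+n k))) = refl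
occ-shift j (lam w) = occ-shift (suc j) w
occ-shift j (app w b) rewrite occ-shift j w | occ-shift j b = refl
occ-shift j []ᵇ = refl
occ-shift j (t ∷ᵇ b) rewrite occ-shift j t | occ-shift j b = refl

msub-shift-[] : ∀ {s} j (w : Exp s) → msub j (shift j w) [] ≈ (w ∷ [])
msub-shift-[] j (var k) with <-cmp k j
... | tri< k<j _ _ rewrite shift-var-< k<j | msub-var-≢ {j} {k} [] (<⇒≢ k<j) | unshiftVar-< k<j = ↭-refl
... | tri≈ _ refl _ rewrite shift-var-≥ {k} {k} ≤-refl | msub-var-≢ {k} {suc k} [] (λ e → <-irrefl (sym e) ≤-refl) | unshiftVar-> {k} {suc k} ≤-refl = ↭-refl
... | tri> _ _ j<k rewrite shift-var-≥ (<⇒≤ j<k) | msub-var-≢ {j} {suc k} [] (λ e → <-irrefl (sym e) (≤-trans j<k (n≤1+n k))) | unshiftVar-> {j} {suc k} (≤-trans j<k (n≤1+n k)) = ↭-refl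
msub-shift-[] j (lam w) = map-≈ lam ≃-lam (msub-shift-[] (suc j) w)
msub-shift-[] j (app w b) = ++⁺ʳ [] (prod-cong app ≃-app (msub-shift-[] j w) (msub-shift-[] j b))
msub-shift-[] j []ᵇ = ↭-refl
msub-shift-[] j (t ∷ᵇ b) = ++⁺ʳ [] (prod-cong _∷ᵇ_ ≃-cons (msub-shift-[] j t) (msub-shift-[] j b))

map-ifEmpty : ∀ {s s'} (f : Exp s → Exp s') (L : List Term) x → map f (ifEmpty L (x ∷ [])) ≡ ifEmpty L (f x ∷ [])
map-ifEmpty f [] x = refl
map-ifEmpty f (_ ∷ _) x = refl

suc-pred-pos : ∀ {a b} → a < b → suc (pred b) ≡ b
suc-pred-pos (s≤s _) = refl

msub-shift-var-≥ : ∀ i d k L → i ≤ d → i ≤ k → msub (suc d) (shift i (var k)) L ≈ map (shift i) (msub d (var k) L)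
msub-shift-var-≥ i d k L le ik rewrite shift-var-≥ ik with <-cmp k d
... | tri< k<d _ _ rewrite msub-var-≢ {suc d} {suc k} L (λ e → <-irrefl (cong pred e) k<d) | msub-var-≢ {d} {k} L (<⇒≢ k<d)
    | unshiftVar-< {suc d} {suc k} (s≤s k<d) | unshiftVar-< k<d | map-ifEmpty (shift i) L (var k) | shift-var-≥ ik = ↭-refl
... | tri≈ _ refl _ = eqc L
    where
    eqc : ∀ L → msub (suc k) (var (suc k)) L ≈ map (shift i) (msub k (var k) L)
    eqc [] rewrite msub-var-≡-[] {suc k} | msub-var-≡-[] {k} = ↭-refl
    eqc (v ∷ []) rewrite msub-var-≡-single {suc k} v | msub-var-≡-single {k} v = Hom.prep (≡⇒≃ (sym (shift-weaken k v i le))) ↭-refl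
    eqc (v ∷ v' ∷ L) = ↭-refl
... | tri> _ _ d<k rewrite msub-var-≢ {suc d} {suc k} L (λ e → <-irrefl (cong pred (sym e)) d<k) | msub-var-≢ {d} {k} L (λ e → <-irrefl (sym e) d<k)
    | unshiftVar-> {suc d} {suc k} (s≤s d<k) | unshiftVar-> d<k | map-ifEmpty (shift i) L (var (pred k)) | shift-var-≥ {i} {pred k} (≤-trans le (<⇒≤pred d<k)) | suc-pred-pos d<k = ↭-refl

msub-shift : ∀ {s} i d (w : Exp s) L → i ≤ d → msub (suc d) (shift i w) L ≈ map (shift i) (msub d w L)
msub-shift i d (var k) L le with <-cmp k i
msub-shift i d (var k) (v ∷ v' ∷ L) le | tri< _ _ _ rewrite shift-var i k = ↭-refl
msub-shift i d (var k) [] le | tri< k<i _ _ rewrite shift-var-< k<i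
  | msub-var-≢ {suc d} {k} [] (λ e → <-irrefl e (≤-trans k<i (≤-trans le (n≤1+n d))))
  | msub-var-≢ {d} {k} [] (λ e → <-irrefl e (≤-trans k<i le))
  | unshiftVar-< {suc d} {k} (≤-trans k<i (≤-trans le (n≤1+n d))) | unshiftVar-< {d} {k} (≤-trans k<i le) | shift-var-< k<i = ↭-refl
msub-shift i d (var k) (v ∷ []) le | tri< k<i _ _ rewrite shift-var-< k<i
  | msub-var-≢ {suc d} {k} (v ∷ []) (λ e → <-irrefl e (≤-trans k<i (≤-trans le (n≤1+n d))))
  | msub-var-≢ {d} {k} (v ∷ []) (λ e → <-irrefl e (≤-trans k<i le)) = ↭-refl
msub-shift i d (var k) L le | tri≈ _ k≡i _ = msub-shift-var-≥ i d k L le (≤-reflexive (sym k≡i))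
msub-shift i d (var k) L le | tri> _ _ i<k = msub-shift-var-≥ i d k L le (<⇒≤ i<k)
msub-shift i d (lam w) L le =
  map-≈ lam ≃-lam (msub-shift (suc i) (suc d) w L (s≤s le)) ⊚ ↭-reflexive (trans (sym (map-∘ (msub (suc d) w L))) (map-∘ (msub (suc d) w L)))
msub-shift i d (app e c) L le =
  Σsplits-↭ L (λ X Y → prod-cong app ≃-app (msub-shift i d e X le) (msub-shift i d c Y le)
                      ⊚ ↭-reflexive (sym (map-prod app (shift i) (shift i) (shift i) (λ x y → refl) (msub d e X) (msub d c Y))))
  ⊚ ↭-reflexive (sym (map-concatMap (shift i) _ (splits L)))
msub-shift i d []ᵇ [] le = ↭-refl
msub-shift i d []ᵇ (x ∷ L) le = ↭-refl
msub-shift i d (t ∷ᵇ b) L le =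
  Σsplits-↭ L (λ X Y → prod-cong _∷ᵇ_ ≃-cons (msub-shift i d t X le) (msub-shift i d b Y le)
                      ⊚ ↭-reflexive (sym (map-prod _∷ᵇ_ (shift i) (shift i) (shift i) (λ x y → refl) (msub d t X) (msub d b Y))))
  ⊚ ↭-reflexive (sym (map-concatMap (shift i) _ (splits L)))

msub-weaken : ∀ j d (c : Term) L → msub (j + d) (weaken j c) L ≈ map (weaken j) (msub d c L)
msub-weaken zero d c L = ↭-reflexive (sym (map-id (msub d c L)))
msub-weaken (suc j) d c L =
  msub-shift 0 (j + d) (weaken j c) L z≤n
  ⊚ map-≈ (shift 0) (shift-≃ 0) (msub-weaken j d c L)
  ⊚ ↭-reflexive (sym (map-∘ (msub d c L)))

module _ {s : Sort} where
  concatMap-Σsplits-comm : ∀ {I : Set} (X : List I) L (F : I → List Term → List Term → Sum s) →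
    concatMap (λ x → Σsplits L (F x)) X ≈ Σsplits L (λ A B → concatMap (λ x → F x A B) X)
  concatMap-Σsplits-comm X L F = concatMap-comm (λ x p → F x (proj₁ p) (proj₂ p)) X (splits L)

  Σsplits-comm : ∀ L M (F : List Term → List Term → List Term → List Term → Sum s) →
    Σsplits L (λ A B → Σsplits M (F A B)) ≈ Σsplits M (λ C D → Σsplits L (λ A B → F A B C D))
  Σsplits-comm L M F = concatMap-comm (λ p q → F (proj₁ p) (proj₂ p) (proj₁ q) (proj₂ q)) (splits L) (splits M)

  concatMap-msubs-∷ : ∀ d c C B (G : List Term → Sum s) → concatMap G (msubs d (c ∷ C) B) ≡
    Σsplits B (λ B1 B2 → concatMap (λ c' → concatMap (λ D → G (c' ∷ D)) (msubs d C B2)) (msub d c B1))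
  concatMap-msubs-∷ d c C B G =
    trans (concatMap-concatMap {B = Term} G _ (splits B))
      (concatMap-cong (λ p →
        trans (concatMap-concatMap {B = Term} G _ (msub d c (proj₁ p)))
          (concatMap-cong (λ c' → concatMap-map G (c' ∷_) (msubs d C (proj₂ p))) (msub d c (proj₁ p)))) (splits B))

  concatMap-msubs-[]-Σsplits : ∀ d B (H : List Term → List Term → Sum s) →
    concatMap (λ D → Σsplits D H) (msubs d [] B) ≈
    Σsplits [] (λ C1 C2 → Σsplits B (λ B1 B2 → concatMap (λ D1 → concatMap (λ D2 → H D1 D2) (msubs d C2 B2)) (msubs d C1 B1)))
  concatMap-msubs-[]-Σsplits d B H =
    ↭-reflexive (concatMap-ifEmpty (λ D → Σsplits D H) B [])
    ⊚ ifEmpty-++-[] B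
    ⊚ ↭-sym (++⁺ʳ [] (Σsplits-↭ B (λ B1 B2 → ↭-reflexive (msubs-[]-nested B1 B2)) ⊚ Σsplits-ifEmptyˡ B (λ B2 → ifEmpty B2 (H [] [] ++ []) ++ [])))
    where
    msubs-[]-nested : ∀ B1 B2 → concatMap (λ D1 → concatMap (λ D2 → H D1 D2) (msubs d [] B2)) (msubs d [] B1) ≡ ifEmpty B1 (ifEmpty B2 (H [] [] ++ []) ++ [])
    msubs-[]-nested [] [] = refl
    msubs-[]-nested [] (_ ∷ _) = refl
    msubs-[]-nested (_ ∷ _) B2 = refl
    ifEmpty-++-[] : ∀ B → ifEmpty B ((H [] [] ++ []) ++ []) ≈ (ifEmpty B (H [] [] ++ []) ++ []) ++ []
    ifEmpty-++-[] [] = ↭-sym (++-identityʳ _)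
    ifEmpty-++-[] (_ ∷ _) = ↭-refl

  concatMap-msubs-Σsplits : ∀ d C B (H : List Term → List Term → Sum s) →
    concatMap (λ D → Σsplits D H) (msubs d C B) ≈
    Σsplits C (λ C1 C2 → Σsplits B (λ B1 B2 → concatMap (λ D1 → concatMap (λ D2 → H D1 D2) (msubs d C2 B2)) (msubs d C1 B1)))
  concatMap-msubs-Σsplits d [] = concatMap-msubs-[]-Σsplits d
  concatMap-msubs-Σsplits d (c ∷ C') B H =
    ↭-reflexive (concatMap-msubs-∷ d c C' B (λ D → Σsplits D H))
    ⊚ Σsplits-↭ B (λ B1 B2 →
        concatMap-↭ (msub d c B1) (λ c' → concatMap-↭ (msubs d C' B2) (λ D → ↭-reflexive (Σsplits-∷ c' D H))
                                    ⊚ concatMap-++-distrib (λ D → Σsplits D (H1 c')) (λ D → Σsplits D (H2 c')) (msubs d C' B2))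
        ⊚ concatMap-++-distrib (λ c' → concatMap (λ D → Σsplits D (H1 c')) (msubs d C' B2)) (λ c' → concatMap (λ D → Σsplits D (H2 c')) (msubs d C' B2)) (msub d c B1))
    ⊚ Σsplits-++ B _ _
    ⊚ ++⁺ part1 part2
    ⊚ ↭-reflexive (sym (Σsplits-∷ c C' R))
    where
    H1 : Term → List Term → List Term → Sum s
    H1 c' X Y = H (c' ∷ X) Y
    H2 : Term → List Term → List Term → Sum s
    H2 c' X Y = H X (c' ∷ Y)
    R : List Term → List Term → Sum s
    R X Y = Σsplits B (λ B1 B2 → concatMap (λ D1 → concatMap (λ D2 → H D1 D2) (msubs d Y B2)) (msubs d X B1))
    M1 : Term → List Term → List Term → List Term → List Term → Sum s
    M1 c' C1 C2 B21 B22 = concatMap (λ D1 → concatMap (λ D2 → H (c' ∷ D1) D2) (msubs d C2 B22)) (msubs d C1 B21)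
    M2 : Term → List Term → List Term → List Term → List Term → Sum s
    M2 c' C1 C2 B21 B22 = concatMap (λ D1 → concatMap (λ D2 → H D1 (c' ∷ D2)) (msubs d C2 B22)) (msubs d C1 B21)
    part1 : Σsplits B (λ B1 B2 → concatMap (λ c' → concatMap (λ D → Σsplits D (H1 c')) (msubs d C' B2)) (msub d c B1))
            ≈ Σsplits C' (λ C1 C2 → R (c ∷ C1) C2)
    part1 =
      Σsplits-↭ B (λ B1 B2 → concatMap-↭ (msub d c B1) (λ c' → concatMap-msubs-Σsplits d C' B2 (H1 c'))
                            ⊚ concatMap-Σsplits-comm (msub d c B1) C' (λ c' C1 C2 → Σsplits B2 (M1 c' C1 C2))
                            ⊚ Σsplits-↭ C' (λ C1 C2 → concatMap-Σsplits-comm (msub d c B1) B2 (λ c' → M1 c' C1 C2)))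
      ⊚ Σsplits-comm B C' (λ B1 B2 C1 C2 → Σsplits B2 (λ B21 B22 → concatMap (λ c' → M1 c' C1 C2 B21 B22) (msub d c B1)))
      ⊚ Σsplits-↭ C' (λ C1 C2 → Σsplits-assoc B (λ B1 B21 B22 → concatMap (λ c' → M1 c' C1 C2 B21 B22) (msub d c B1))
                               ⊚ Σsplits-↭ B (λ B1 B2 → ↭-reflexive (sym (concatMap-msubs-∷ d c C1 B1 (λ D1 → concatMap (λ D2 → H D1 D2) (msubs d C2 B2))))))
    part2 : Σsplits B (λ B1 B2 → concatMap (λ c' → concatMap (λ D → Σsplits D (H2 c')) (msubs d C' B2)) (msub d c B1))
            ≈ Σsplits C' (λ C1 C2 → R C1 (c ∷ C2))
    part2 =
      Σsplits-↭ B (λ B1 B2 → concatMap-↭ (msub d c B1) (λ c' → concatMap-msubs-Σsplits d C' B2 (H2 c'))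
                            ⊚ concatMap-Σsplits-comm (msub d c B1) C' (λ c' C1 C2 → Σsplits B2 (M2 c' C1 C2))
                            ⊚ Σsplits-↭ C' (λ C1 C2 → concatMap-Σsplits-comm (msub d c B1) B2 (λ c' → M2 c' C1 C2)))
      ⊚ Σsplits-comm B C' (λ B1 B2 C1 C2 → Σsplits B2 (λ B21 B22 → concatMap (λ c' → M2 c' C1 C2 B21 B22) (msub d c B1)))
      ⊚ Σsplits-↭ C' (λ C1 C2 → Σsplits-exchange B (λ B1 B21 B22 → concatMap (λ c' → M2 c' C1 C2 B21 B22) (msub d c B1))
          ⊚ Σsplits-↭ B (λ B1 B2 → Σsplits-↭ B2 (λ B21 B22 →
               concatMap-comm (λ c' D1 → concatMap (λ D2 → H D1 (c' ∷ D2)) (msubs d C2 B22)) (msub d c B21) (msubs d C1 B1))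
             ⊚ ↭-sym (concatMap-Σsplits-comm (msubs d C1 B1) B2 (λ D1 B21 B22 → concatMap (λ c' → concatMap (λ D → H D1 (c' ∷ D)) (msubs d C2 B22)) (msub d c B21)))
             ⊚ concatMap-↭ (msubs d C1 B1) (λ D1 → ↭-reflexive (sym (concatMap-msubs-∷ d c C2 B2 (H D1))))))

prod-concatMap : ∀ {s1 s2 s3} (f : Exp s1 → Exp s2 → Exp s3) {I J : Set} (F : I → Sum s1) (G : J → Sum s2) X Y →
  prod f (concatMap F X) (concatMap G Y) ≈ concatMap (λ x → concatMap (λ y → prod f (F x) (G y)) Y) X
prod-concatMap f F G X Y = ↭-reflexive (prod-concatMapˡ f F X (concatMap G Y)) ⊚ concatMap-↭ X (λ x → prod-concatMapʳ f (F x) G Y)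

msub-var-< : ∀ {d k} L → k < d → msub d (var k) L ≡ ifEmpty L (var k ∷ [])
msub-var-< L p rewrite msub-var-≢ L (<⇒≢ p) | unshiftVar-< p = refl

msub-var-> : ∀ {d k} L → d < k → msub d (var k) L ≡ ifEmpty L (var (pred k) ∷ [])
msub-var-> L p rewrite msub-var-≢ L (λ e → <-irrefl (sym e) p) | unshiftVar-> p = refl

msub-[]ᵇ : ∀ {d} L → msub d []ᵇ L ≡ ifEmpty L ([]ᵇ ∷ [])
msub-[]ᵇ [] = refl
msub-[]ᵇ (_ ∷ _) = refl

-- The substitution lemma (u⟨C/x⟩)⟨L/y⟩ = Σ_{L = A ⊎ B} (u⟨A/y⟩)⟨C⟨B/y⟩/x⟩, with x the
-- index j and y the index j + d of the body of u⟨C/x⟩, that is j + suc d in u.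
MsubComposes : ∀ {s} → ℕ → ℕ → Exp s → Set
MsubComposes {s} j d u = ∀ C L →
  concatMap (λ u' → msub (j + d) u' L) (msub j u C) ≈
  Σsplits L (λ A B → concatMap (λ u1 → concatMap (λ C1 → msub j u1 C1) (msubs d C B)) (msub (j + suc d) u A))

-- Covers the variables other than x and y, and []ᵇ: each substitution keeps such a
-- leaf, reindexed, exactly when it receives no argument.
composes-inert : ∀ {s} j d (u x1 x3 y : Exp s) →
  (∀ C → msub j u C ≡ ifEmpty C (x1 ∷ [])) → (∀ A → msub (j + suc d) u A ≡ ifEmpty A (x3 ∷ [])) →
  (∀ L → msub (j + d) x1 L ≡ ifEmpty L (y ∷ [])) → (∀ C1 → msub j x3 C1 ≡ ifEmpty C1 (y ∷ [])) → MsubComposes j d u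
composes-inert j d u x1 x3 y h1 h3 h2 h4 C L =
  ↭-reflexive (trans (cong (concatMap (λ u' → msub (j + d) u' L)) (h1 C)) (concatMap-ifEmpty (λ u' → msub (j + d) u' L) C x1))
  ⊚ ↭-reflexive (cong (λ z → ifEmpty C (z ++ [])) (h2 L))
  ⊚ main C
  ⊚ ↭-sym (Σsplits-↭ L (λ A B → ↭-reflexive (trans (cong (concatMap (λ u1 → concatMap (λ C1 → msub j u1 C1) (msubs d C B))) (h3 A))
                                     (trans (concatMap-ifEmpty (λ u1 → concatMap (λ C1 → msub j u1 C1) (msubs d C B)) A x3)
                                            (cong (λ z → ifEmpty A (z ++ [])) (concatMap-cong h4 (msubs d C B)))))))
  where
  main : ∀ C → ifEmpty C (ifEmpty L (y ∷ []) ++ []) ≈ Σsplits L (λ A B → ifEmpty A (concatMap (λ C1 → ifEmpty C1 (y ∷ [])) (msubs d C B) ++ []))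
  main [] = ↭-sym (Σsplits-↭ L (λ A B → ↭-reflexive (cong (λ z → ifEmpty A (z ++ [])) (concatMap-ifEmpty (λ C1 → ifEmpty C1 (y ∷ [])) B [])))
                   ⊚ Σsplits-ifEmptyˡ L (λ B → ifEmpty B (y ∷ []) ++ []))
  main (c ∷ C') = ↭-sym (Σsplits-↭ L (λ A B → ↭-reflexive (cong (λ z → ifEmpty A (z ++ [])) (concatMap-All-[] _ (All.map ifEmpty-nonempty (msubs-length d (c ∷ C') B)))) ⊚ ↭-reflexive (ifEmpty-[] A))
                   ⊚ ↭-reflexive (concatMap-const-[] (splits L)))
    where
    ifEmpty-nonempty : ∀ {C1} → length C1 ≡ suc (length C') → ifEmpty C1 (y ∷ []) ≡ []
    ifEmpty-nonempty {_ ∷ _} _ = refl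

ifSingleton : ∀ {A B : Set} → List A → (A → List B) → List B
ifSingleton [] f = []
ifSingleton (a ∷ []) f = f a
ifSingleton (_ ∷ _ ∷ _) f = []

msub-var-≡ : ∀ n L → msub n (var n) L ≡ ifSingleton L (λ v → weaken n v ∷ [])
msub-var-≡ n [] = msub-var-≡-[] {n}
msub-var-≡ n (v ∷ []) = msub-var-≡-single {n} v
msub-var-≡ n (_ ∷ _ ∷ _) = refl

occ-var-self : ∀ j → occ j (var j) ≡ 1
occ-var-self j rewrite ≡ᵇ-refl j = refl

concatMap-ifEmpty-map : ∀ {s s'} {A : Set} (f : Exp s → Exp s') (B : List A) X → concatMap (λ x → ifEmpty B (f x ∷ [])) X ≡ ifEmpty B (map f X)
concatMap-ifEmpty-map f [] X = sym (map-as-concatMap f X)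
concatMap-ifEmpty-map f (_ ∷ _) X = concatMap-const-[] X

composes-var-j-mismatch : ∀ j d C → length C ≢ 1 → ∀ L →
  concatMap (λ u' → msub (j + d) u' L) (msub j (var j) C) ≈
  Σsplits L (λ A B → concatMap (λ u1 → concatMap (λ C1 → msub j u1 C1) (msubs d C B)) (msub (j + suc d) (var j) A))
composes-var-j-mismatch j d C ne L =
  ↭-reflexive (cong (concatMap (λ u' → msub (j + d) u' L)) (msub-arity-mismatch j (var j) C ne'))
  ⊚ ↭-sym (Σsplits-↭ L (λ A B → ↭-reflexive (h A B)) ⊚ ↭-reflexive (concatMap-const-[] (splits L)))
  where
  ne' : length C ≢ occ j (var j)
  ne' e = ne (trans e (occ-var-self j))
  h : ∀ A B → concatMap (λ u1 → concatMap (λ C1 → msub j u1 C1) (msubs d C B)) (msub (j + suc d) (var j) A) ≡ []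
  h A B = trans (cong (concatMap (λ u1 → concatMap (λ C1 → msub j u1 C1) (msubs d C B))) (msub-var-< A (m<m+suc-n j d)))
         (trans (concatMap-ifEmpty (λ u1 → concatMap (λ C1 → msub j u1 C1) (msubs d C B)) A (var j))
         (trans (cong (λ z → ifEmpty A (z ++ [])) (concatMap-All-[] _ (All.map (λ {C1} e → msub-arity-mismatch j (var j) C1 (λ e' → ne' (trans (sym e) e'))) (msubs-length d C B))))
                (ifEmpty-[] A)))

composes-var-j : ∀ j d → MsubComposes j d (var j)
composes-var-j j d (c ∷ []) L =
  ↭-reflexive (cong (concatMap (λ u' → msub (j + d) u' L)) (msub-var-≡-single {j} c))
  ⊚ ++⁺ʳ [] (msub-weaken j d c L)
  ⊚ ++-identityʳ _
  ⊚ ↭-sym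
    (Σsplits-↭ L (λ A B → ↭-reflexive (trans (cong (concatMap (λ u1 → concatMap (λ C1 → msub j u1 C1) (msubs d (c ∷ []) B))) (msub-var-< A jlt))
                                   (concatMap-ifEmpty (λ u1 → concatMap (λ C1 → msub j u1 C1) (msubs d (c ∷ []) B)) A (var j))))
     ⊚ Σsplits-ifEmptyˡ L (λ B → concatMap (λ C1 → msub j (var j) C1) (msubs d (c ∷ []) B) ++ [])
     ⊚ ++-identityʳ _
     ⊚ ↭-reflexive (concatMap-msubs-∷ d c [] L (λ C1 → msub j (var j) C1))
     ⊚ Σsplits-↭ L (λ B1 B2 → concatMap-↭ (msub d c B1) (λ c' → ↭-reflexive (trans (concatMap-ifEmpty (λ D → msub j (var j) (c' ∷ D)) B2 []) (cong (λ z → ifEmpty B2 (z ++ [])) (msub-var-≡-single {j} c'))))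
                             ⊚ ↭-reflexive (concatMap-ifEmpty-map (weaken j) B2 (msub d c B1)))
     ⊚ Σsplits-ifEmptyʳ L (λ B1 → map (weaken j) (msub d c B1)))
  where
  jlt : j < j + suc d
  jlt = m<m+suc-n j d
composes-var-j j d [] L = composes-var-j-mismatch j d [] (λ ()) L
composes-var-j j d (c ∷ c' ∷ C) L = composes-var-j-mismatch j d (c ∷ c' ∷ C) (λ ()) L

ifEmpty-↭ : ∀ {X : Set} {s} (B : List X) {P Q : Sum s} → P ≈ Q → ifEmpty B P ≈ ifEmpty B Q
ifEmpty-↭ [] p = p
ifEmpty-↭ (_ ∷ _) p = ↭-refl

module _ (j d : ℕ) where
  private
    jlt : j < suc (j + d)
    jlt = s≤s (m≤m+n j d)
    msub-var-y : ∀ A → msub (j + suc d) (var (suc (j + d))) A ≡ ifSingleton A (λ a → weaken (j + suc d) a ∷ [])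
    msub-var-y A rewrite +-suc j d = msub-var-≡ (suc (j + d)) A
    wk-eq : ∀ a → weaken (j + suc d) a ≡ shift j (weaken (j + d) a)
    wk-eq a rewrite +-suc j d = sym (shift-weaken (j + d) a j (m≤m+n j d))

  composes-var-j+1+d : MsubComposes j d (var (suc (j + d)))
  composes-var-j+1+d [] L =
    ↭-reflexive (cong (concatMap (λ u' → msub (j + d) u' L)) (msub-var-> {j} {suc (j + d)} [] jlt))
    ⊚ ↭-reflexive (cong (_++ []) (msub-var-≡ (j + d) L))
    ⊚ ++-identityʳ _
    ⊚ ↭-sym (Σsplits-↭ L (λ A B → ↭-reflexive (cong (concatMap (λ u1 → concatMap (λ C1 → msub j u1 C1) (msubs d [] B))) (msub-var-y A)) ⊚ per A B)
             ⊚ Σsplits-ifEmptyʳ L (λ A → ifSingleton A (λ a → weaken (j + d) a ∷ [])))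
    where
    per : ∀ A B → concatMap (λ u1 → concatMap (λ C1 → msub j u1 C1) (msubs d [] B)) (ifSingleton A (λ a → weaken (j + suc d) a ∷ []))
                  ≈ ifEmpty B (ifSingleton A (λ a → weaken (j + d) a ∷ []))
    per [] B = ↭-reflexive (sym (ifEmpty-[] B))
    per (a ∷ []) B =
      ++-identityʳ _
      ⊚ ↭-reflexive (concatMap-ifEmpty (λ C1 → msub j (weaken (j + suc d) a) C1) B [])
      ⊚ ifEmpty-↭ B (++-identityʳ _ ⊚ ↭-reflexive (cong (λ w → msub j w []) (wk-eq a)) ⊚ msub-shift-[] j (weaken (j + d) a))
    per (_ ∷ _ ∷ _) B = ↭-reflexive (sym (ifEmpty-[] B))
  composes-var-j+1+d (c ∷ C') L =
    ↭-reflexive (cong (concatMap (λ u' → msub (j + d) u' L)) (msub-var-> {j} {suc (j + d)} (c ∷ C') jlt))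
    ⊚ ↭-sym (Σsplits-↭ L (λ A B → ↭-reflexive (trans (cong (concatMap (λ u1 → concatMap (λ C1 → msub j u1 C1) (msubs d (c ∷ C') B))) (msub-var-y A)) (per A B)))
             ⊚ ↭-reflexive (concatMap-const-[] (splits L)))
    where
    per : ∀ A B → concatMap (λ u1 → concatMap (λ C1 → msub j u1 C1) (msubs d (c ∷ C') B)) (ifSingleton A (λ a → weaken (j + suc d) a ∷ [])) ≡ []
    per [] B = refl
    per (a ∷ []) B = cong (_++ []) (concatMap-All-[] _ (All.map (λ {C1} e → msub-arity-mismatch j (weaken (j + suc d) a) C1 (λ e' → 0≢1+n (trans (sym (trans (cong (occ j) (wk-eq a)) (occ-shift j (weaken (j + d) a)))) (trans (sym e') e)))) (msubs-length d (c ∷ C') B)))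
    per (_ ∷ _ ∷ _) B = refl

composes-lam : ∀ j d u → MsubComposes (suc j) d u → MsubComposes j d (lam u)
composes-lam j d u IH C L =
  ↭-reflexive (concatMap-map (λ u' → msub (j + d) u' L) lam (msub (suc j) u C))
  ⊚ ↭-reflexive (sym (map-concatMap lam (λ x → msub (suc j + d) x L) (msub (suc j) u C)))
  ⊚ map-≈ lam ≃-lam (IH C L)
  ⊚ ↭-reflexive (map-concatMap lam _ (splits L))
  ⊚ concatMap-↭ (splits L) (λ p → ↭-reflexive (per (proj₁ p) (proj₂ p)))
  where
  per : ∀ A B → map lam (concatMap (λ u1 → concatMap (λ C1 → msub (suc j) u1 C1) (msubs d C B)) (msub (suc j + suc d) u A))
                ≡ concatMap (λ w → concatMap (λ C1 → msub j w C1) (msubs d C B)) (map lam (msub (suc j + suc d) u A))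
  per A B = trans (map-concatMap lam _ (msub (suc j + suc d) u A))
    (trans (concatMap-cong (λ u1 → map-concatMap lam (λ C1 → msub (suc j) u1 C1) (msubs d C B)) (msub (suc j + suc d) u A))
           (sym (concatMap-map (λ w → concatMap (λ C1 → msub j w C1) (msubs d C B)) lam (msub (suc j + suc d) u A))))

composes-prod : ∀ {s1 s2 s3} (f : Exp s1 → Exp s2 → Exp s3) (fc : ≃-Congruent₂ f)
  (msub-f : ∀ n x y M → msub n (f x y) M ≡ Σsplits M (λ M1 M2 → prod f (msub n x M1) (msub n y M2)))
  j d (e : Exp s1) (c : Exp s2) → MsubComposes j d e → MsubComposes j d c → MsubComposes j d (f e c)
composes-prod {s1} {s2} {s3} f fc msub-f j d e c IHe IHc C L = lhs ⊚ ↭-sym rhs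
  where
  F : Exp s3 → Sum s3
  F u' = msub (j + d) u' L
  inner-e : List Term → List Term → List Term → Sum s1
  inner-e C1 A1 B1 = concatMap (λ a1 → concatMap (λ D1 → msub j a1 D1) (msubs d C1 B1)) (msub (j + suc d) e A1)
  inner-c : List Term → List Term → List Term → Sum s2
  inner-c C2 A2 B2 = concatMap (λ a2 → concatMap (λ D2 → msub j a2 D2) (msubs d C2 B2)) (msub (j + suc d) c A2)
  N : List Term → List Term → List Term → List Term → Exp s1 → Exp s2 → Sum s3
  N C1 C2 B1 B2 a1 a2 = concatMap (λ D1 → concatMap (λ D2 → prod f (msub j a1 D1) (msub j a2 D2)) (msubs d C2 B2)) (msubs d C1 B1)
  W : List Term → List Term → List Term → List Term → List Term → List Term → Sum s3
  W C1 C2 A1 A2 B1 B2 = concatMap (λ a1 → concatMap (λ a2 → N C1 C2 B1 B2 a1 a2) (msub (j + suc d) c A2)) (msub (j + suc d) e A1)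
  target : Sum s3
  target = Σsplits C (λ C1 C2 → Σsplits L (λ A B → Σsplits A (λ A1 A2 → Σsplits B (λ B1 B2 → W C1 C2 A1 A2 B1 B2))))
  outer-prod : ∀ X Y → concatMap F (prod f X Y) ≈
       Σsplits L (λ L1 L2 → prod f (concatMap (λ x → msub (j + d) x L1) X) (concatMap (λ y → msub (j + d) y L2) Y))
  outer-prod X Y = ↭-reflexive (concatMap-concatMap {B = Term} F (λ x → map (f x) Y) X)
    ⊚ concatMap-↭ X (λ x → ↭-reflexive (concatMap-map F (f x) Y) ⊚ concatMap-↭ Y (λ y → ↭-reflexive (msub-f (j + d) x y L))
                       ⊚ concatMap-Σsplits-comm Y L (λ y L1 L2 → prod f (msub (j + d) x L1) (msub (j + d) y L2)))
    ⊚ concatMap-Σsplits-comm X L (λ x L1 L2 → concatMap (λ y → prod f (msub (j + d) x L1) (msub (j + d) y L2)) Y)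
    ⊚ Σsplits-↭ L (λ L1 L2 → ↭-sym (prod-concatMap f (λ x → msub (j + d) x L1) (λ y → msub (j + d) y L2) X Y))
  inner-prod : ∀ C1 C2 A1 A2 B1 B2 → prod f (inner-e C1 A1 B1) (inner-c C2 A2 B2) ≈ W C1 C2 A1 A2 B1 B2
  inner-prod C1 C2 A1 A2 B1 B2 =
    prod-concatMap f (λ a1 → concatMap (λ D1 → msub j a1 D1) (msubs d C1 B1)) (λ a2 → concatMap (λ D2 → msub j a2 D2) (msubs d C2 B2)) (msub (j + suc d) e A1) (msub (j + suc d) c A2)
    ⊚ concatMap-↭ (msub (j + suc d) e A1) (λ a1 → concatMap-↭ (msub (j + suc d) c A2) (λ a2 → prod-concatMap f (msub j a1) (msub j a2) (msubs d C1 B1) (msubs d C2 B2)))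
  lhs : concatMap F (msub j (f e c) C) ≈ target
  lhs = ↭-reflexive (cong (concatMap F) (msub-f j e c C))
    ⊚ ↭-reflexive (concatMap-concatMap {B = Term} F _ (splits C))
    ⊚ Σsplits-↭ C (λ C1 C2 → outer-prod (msub j e C1) (msub j c C2)
        ⊚ Σsplits-↭ L (λ L1 L2 → prod-cong f fc (IHe C1 L1) (IHc C2 L2)
                                ⊚ prod-concatMap f (λ p → inner-e C1 (proj₁ p) (proj₂ p)) (λ p → inner-c C2 (proj₁ p) (proj₂ p)) (splits L1) (splits L2))
        ⊚ Σsplits-transpose L (λ A1 B1 A2 B2 → prod f (inner-e C1 A1 B1) (inner-c C2 A2 B2))
        ⊚ Σsplits-↭ L (λ A B → Σsplits-↭ A (λ A1 A2 → Σsplits-↭ B (λ B1 B2 → inner-prod C1 C2 A1 A2 B1 B2))))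
  G : List Term → Exp s3 → Sum s3
  G B u1 = concatMap (λ D → msub j u1 D) (msubs d C B)
  per : ∀ A B → concatMap (G B) (msub (j + suc d) (f e c) A) ≈ Σsplits C (λ C1 C2 → Σsplits A (λ A1 A2 → Σsplits B (λ B1 B2 → W C1 C2 A1 A2 B1 B2)))
  per A B =
    ↭-reflexive (cong (concatMap (G B)) (msub-f (j + suc d) e c A))
    ⊚ ↭-reflexive (concatMap-concatMap {B = Term} (G B) _ (splits A))
    ⊚ Σsplits-↭ A (λ A1 A2 →
        ↭-reflexive (concatMap-concatMap {B = Term} (G B) (λ a1 → map (f a1) (msub (j + suc d) c A2)) (msub (j + suc d) e A1))
        ⊚ concatMap-↭ (msub (j + suc d) e A1) (λ a1 → ↭-reflexive (concatMap-map (G B) (f a1) (msub (j + suc d) c A2))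
            ⊚ concatMap-↭ (msub (j + suc d) c A2) (λ a2 →
                 concatMap-↭ (msubs d C B) (λ D → ↭-reflexive (msub-f j a1 a2 D))
                 ⊚ concatMap-msubs-Σsplits d C B (λ D1 D2 → prod f (msub j a1 D1) (msub j a2 D2)))
            ⊚ concatMap-Σsplits-comm (msub (j + suc d) c A2) C (λ a2 C1 C2 → Σsplits B (λ B1 B2 → N C1 C2 B1 B2 a1 a2)))
        ⊚ concatMap-Σsplits-comm (msub (j + suc d) e A1) C (λ a1 C1 C2 → concatMap (λ a2 → Σsplits B (λ B1 B2 → N C1 C2 B1 B2 a1 a2)) (msub (j + suc d) c A2))
        ⊚ Σsplits-↭ C (λ C1 C2 →
            concatMap-↭ (msub (j + suc d) e A1) (λ a1 → concatMap-Σsplits-comm (msub (j + suc d) c A2) B (λ a2 B1 B2 → N C1 C2 B1 B2 a1 a2))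
            ⊚ concatMap-Σsplits-comm (msub (j + suc d) e A1) B (λ a1 B1 B2 → concatMap (λ a2 → N C1 C2 B1 B2 a1 a2) (msub (j + suc d) c A2))))
    ⊚ Σsplits-comm A C (λ A1 A2 C1 C2 → Σsplits B (λ B1 B2 → W C1 C2 A1 A2 B1 B2))
  rhs : Σsplits L (λ A B → concatMap (λ u1 → concatMap (λ C1 → msub j u1 C1) (msubs d C B)) (msub (j + suc d) (f e c) A)) ≈ target
  rhs = Σsplits-↭ L (λ A B → per A B)
    ⊚ Σsplits-comm L C (λ A B C1 C2 → Σsplits A (λ A1 A2 → Σsplits B (λ B1 B2 → W C1 C2 A1 A2 B1 B2)))

composes-var-between : ∀ j d k' → j < suc k' → suc k' < j + suc d → MsubComposes j d (var (suc k'))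
composes-var-between j d k' p q =
  composes-inert j d (var (suc k')) (var k') (var (suc k')) (var k') (λ C → msub-var-> C p) (λ A → msub-var-< A q) (λ L → msub-var-< L q') (λ C1 → msub-var-> C1 p)
  where
  q' : k' < j + d
  q' = ≤-pred (subst (suc (suc k') ≤_) (+-suc j d) q)

composes-var-above : ∀ j d k' → j + suc d < suc k' → MsubComposes j d (var (suc k'))
composes-var-above j d k' p =
  composes-inert j d (var (suc k')) (var k') (var k') (var (pred k')) (λ C → msub-var-> C p1) (λ A → msub-var-> A p) (λ L → msub-var-> L p2) (λ C1 → msub-var-> C1 p3)
  where
  p2 : j + d < k'
  p2 = ≤-pred (subst (_< suc k') (+-suc j d) p)
  p3 : j < k'
  p3 = ≤-<-trans (m≤m+n j d) p2
  p1 : j < suc k'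
  p1 = ≤-trans p3 (n≤1+n k')

composes-var : ∀ j d k → MsubComposes j d (var k)
composes-var j d k with <-cmp k j
... | tri< k<j _ _ = composes-inert j d (var k) (var k) (var k) (var k) (λ C → msub-var-< C k<j)
        (λ A → msub-var-< A (≤-trans k<j (m≤m+n j (suc d)))) (λ L → msub-var-< L (≤-trans k<j (m≤m+n j d))) (λ C1 → msub-var-< C1 k<j)
... | tri≈ _ refl _ = composes-var-j k d
... | tri> _ _ j<k = hi k j<k
  where
  hi : ∀ k → j < k → MsubComposes j d (var k)
  hi (suc k') j<k with <-cmp (suc k') (j + suc d)
  ... | tri< q _ _ = composes-var-between j d k' j<k q
  ... | tri≈ _ e _ = subst (λ n → MsubComposes j d (var n)) (trans (sym (+-suc j d)) (sym e)) (composes-var-j+1+d j d)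
  ... | tri> _ _ p = composes-var-above j d k' p

msub-composition : ∀ {s} j d (u : Exp s) → MsubComposes j d u
msub-composition j d (var k) = composes-var j d k
msub-composition j d (lam u) = composes-lam j d u (msub-composition (suc j) d u)
msub-composition j d (app e c) = composes-prod app ≃-app (λ n x y M → refl) j d e c (msub-composition j d e) (msub-composition j d c)
msub-composition j d []ᵇ = composes-inert j d []ᵇ []ᵇ []ᵇ []ᵇ msub-[]ᵇ msub-[]ᵇ msub-[]ᵇ msub-[]ᵇ
msub-composition j d (t ∷ᵇ b) = composes-prod _∷ᵇ_ ≃-cons (λ n x y M → refl) j d t b (msub-composition j d t) (msub-composition j d b)

β-map : ∀ {u : Term} X → Par (map (app (lam u)) X) (concatMap (msubst u) X)
β-map {u} X = Par-resp (↭-reflexive (map-as-concatMap (app (lam u)) X)) (Par-concatMap (λ b → app (lam u) b ∷ []) (msubst u) X (λ b → Par-step β)) ↭-refl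

msub-body-step : ∀ {s} {u : Exp s} {σ} → u →r σ → ∀ d L → Par (msub d u L) (concatMap (λ u' → msub d u' L) σ)
msub-body-step (β {u} {b}) d L =
  Par-resp ↭-refl
    (Par-concatMap _ (λ p → concatMap (λ u1 → concatMap (msubst u1) (msub d b (proj₂ p))) (msub (suc d) u (proj₁ p))) (splits L)
       (λ p → Par-resp (↭-reflexive (concatMap-map (λ x → map (app x) (msub d b (proj₂ p))) lam (msub (suc d) u (proj₁ p))))
                (Par-concatMap _ _ (msub (suc d) u (proj₁ p)) (λ u1 → β-map (msub d b (proj₂ p)))) ↭-refl))
    (Σsplits-↭ L (λ X Y → concatMap-↭ (msub (suc d) u X) (λ u1 →
         concatMap-↭ (msub d b Y) (λ c1 → msubst≈msub u1 c1)
         ⊚ ↭-reflexive (trans (sym (concatMap-map (msub 0 u1) bagToList (msub d b Y))) (cong (concatMap (msub 0 u1)) (msubs-bag d b Y)))))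
     ⊚ ↭-sym (msub-composition 0 d u (bagToList b) L)
     ⊚ concatMap-Permutation _≃_ (λ u' → msub d u' L) (↭-sym (msubst≈msub u b)) (λ e → msub-≃ e d L))
msub-body-step (ξ-lam {σ = σ} r) d L =
  Par-resp ↭-refl (Par-lam (msub-body-step r (suc d) L))
    (↭-reflexive (map-concatMap lam _ σ) ⊚ ↭-reflexive (sym (concatMap-map (λ s' → msub d s' L) lam σ)))
msub-body-step (ξ-appˡ {u} {σ} {b} r) d L =
  Par-resp ↭-refl
    (Par-concatMap _ (λ p → prod app (concatMap (λ u' → msub d u' (proj₁ p)) σ) (msub d b (proj₂ p))) (splits L)
       (λ p → Par-appˡ (msub-body-step r d (proj₁ p)) (msub d b (proj₂ p))))
    (Σsplits-↭ L (λ X Y → ↭-reflexive (prod-concatMapˡ app (λ u' → msub d u' X) σ (msub d b Y)))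
     ⊚ ↭-sym (concatMap-Σsplits-comm σ L (λ u' X Y → prod app (msub d u' X) (msub d b Y)))
     ⊚ ↭-reflexive (sym (concatMap-map (λ s' → msub d s' L) (λ x → app x b) σ)))
msub-body-step (ξ-appʳ {u} {b} {τ} r) d L =
  Par-resp ↭-refl
    (Par-concatMap _ (λ p → prod app (msub d u (proj₁ p)) (concatMap (λ b' → msub d b' (proj₂ p)) τ)) (splits L)
       (λ p → Par-appʳ (msub-body-step r d (proj₂ p)) (msub d u (proj₁ p))))
    (Σsplits-↭ L (λ X Y → prod-concatMapʳ app (msub d u X) (λ b' → msub d b' Y) τ)
     ⊚ ↭-sym (concatMap-Σsplits-comm τ L (λ b' X Y → prod app (msub d u X) (msub d b' Y)))
     ⊚ ↭-reflexive (sym (concatMap-map (λ s' → msub d s' L) (app u) τ)))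
msub-body-step (ξ-bag {b} {u} {t} {σ} q r) d L =
  Par-resp (msub-≃ q d L)
    (Par-concatMap _ (λ p → prod _∷ᵇ_ (concatMap (λ u' → msub d u' (proj₁ p)) σ) (msub d t (proj₂ p))) (splits L)
       (λ p → Par-∷ᵇˡ (msub-body-step r d (proj₁ p)) (msub d t (proj₂ p))))
    (Σsplits-↭ L (λ X Y → ↭-reflexive (prod-concatMapˡ _∷ᵇ_ (λ u' → msub d u' X) σ (msub d t Y)))
     ⊚ ↭-sym (concatMap-Σsplits-comm σ L (λ u' X Y → prod _∷ᵇ_ (msub d u' X) (msub d t Y)))
     ⊚ ↭-reflexive (sym (concatMap-map (λ s' → msub d s' L) (_∷ᵇ t) σ)))

-- Local diamond property

∷-↭-∷-inv : ∀ {x y : Term} {xs ys} → (x ∷ xs) ≈ (y ∷ ys) →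
      (x ≃ y × xs ≈ ys) ⊎ (Σ[ zs ∈ List Term ] (xs ≈ (y ∷ zs) × ys ≈ (x ∷ zs)))
∷-↭-∷-inv {x} {y} {xs} {ys} p with ↭-split y [] ys p
... | [] , Q , e PW.∷ pw , pq = inj₁ (e , (Hom.refl pw ⊚ pq))
... | (z ∷ P) , Q , e PW.∷ pw , pq =
  inj₂ (P ++ Q , (Hom.refl pw ⊚ ↭-shift P Q) , (↭-sym pq ⊚ Hom.prep (≃-sym e) ↭-refl))

↭⇒bag-≃ : ∀ {xs} {t : Bag} → bagToList t ≈ xs → t ≃ listToBag xs
↭⇒bag-≃ {xs} {t} p = subst (_≃ listToBag xs) (listToBag-bagToList t) (↭⇒listToBag-≃ p)

β-map-lam : ∀ {b : Bag} X → Par (map (λ x → app x b) (map lam X)) (concatMap (λ u' → msubst u' b) X)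
β-map-lam {b} X = Par-resp (↭-reflexive (trans (sym (map-∘ X)) (map-as-concatMap (λ x → app (lam x) b) X)))
  (Par-concatMap (λ x → app (lam x) b ∷ []) (λ u' → msubst u' b) X (λ x → Par-step β)) ↭-refl

msubst-body-step : ∀ {u : Term} {b σ} → u →r σ → Par (msubst u b) (concatMap (λ u' → msubst u' b) σ)
msubst-body-step {u} {b} {σ} r = Par-resp (msubst≈msub u b) (msub-body-step r 0 (bagToList b)) (concatMap-↭ σ (λ u' → ↭-sym (msubst≈msub u' b)))

msubst-arg-step : ∀ {u : Term} {b τ} → b →r τ → Par (msubst u b) (concatMap (msubst u) τ)
msubst-arg-step {u} {b} (ξ-bag {t = t'} {σ = σt} q r) =
  Par-resp (msubst≈msub u b ⊚ msub-↭ 0 u (≃⇒bagToList-↭ q)) (msub-arg-step r 0 u (bagToList t'))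
    (concatMap-↭ σt (λ x → ↭-sym (msubst≈msub u (x ∷ᵇ t'))) ⊚ ↭-reflexive (sym (concatMap-map (msubst u) (_∷ᵇ t') σt)))

Par-map-appˡ : ∀ b {A A'} → Par A A' → Par (map (λ x → app x b) A) (map (λ x → app x b) A')
Par-map-appˡ b = ParMap.Par-map (λ x → app x b) (λ z → ≃-app z ≃-refl) app-stepˡ

Par-map-appʳ : ∀ u {A A'} → Par A A' → Par (map (app u) A) (map (app u) A')
Par-map-appʳ u = ParMap.Par-map (app u) (≃-app ≃-refl) app-stepʳ

Par-map-∷ᵇˡ : ∀ t {A A'} → Par A A' → Par (map (_∷ᵇ t) A) (map (_∷ᵇ t) A')
Par-map-∷ᵇˡ t = ParMap.Par-map (_∷ᵇ t) (λ z → ≃-cons z ≃-refl) ∷ᵇ-stepˡ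

app-steps-join : ∀ {u b σ τ} → u →r σ → b →r τ → Par (map (λ x → app x b) σ) (prod app σ τ) × Par (map (app u) τ) (prod app σ τ)
app-steps-join {u} {b} {σ} {τ} r r' =
  Par-resp (↭-reflexive (map-as-concatMap (λ x → app x b) σ)) (Par-appʳ (Par-step r') σ) ↭-refl ,
  Par-resp (↭-sym (++-identityʳ _)) (Par-appˡ (Par-step r) τ) ↭-refl

∷ᵇ∷ᵇ-swap-sum : ∀ {σ σ'} (R : Bag) → concatMap (λ v' → map (λ v → v' ∷ᵇ v ∷ᵇ R) σ) σ' ≈ concatMap (λ v → map (λ v' → v ∷ᵇ v' ∷ᵇ R) σ') σ
∷ᵇ∷ᵇ-swap-sum {σ} {σ'} R =
  concatMap-↭ σ' (λ v' → ↭-reflexive (map-as-concatMap (λ v → v' ∷ᵇ v ∷ᵇ R) σ))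
  ⊚ concatMap-comm (λ v' v → (v' ∷ᵇ v ∷ᵇ R) ∷ []) σ' σ
  ⊚ concatMap-↭ σ (λ v → concatMap-↭ σ' (λ v' → Hom.prep ≃-swap ↭-refl) ⊚ ↭-reflexive (sym (map-as-concatMap (λ v' → v ∷ᵇ v' ∷ᵇ R) σ')))

bag-step-other : ∀ {t u' σ σ'} {R : Bag} → t ≃ (u' ∷ᵇ R) → u' →r σ' →
       Par (map (_∷ᵇ t) σ) (concatMap (λ v → map (λ v' → v ∷ᵇ v' ∷ᵇ R) σ') σ)
bag-step-other {t} {u'} {σ} {σ'} {R} tq r' =
  Par-resp (↭-reflexive (map-as-concatMap (_∷ᵇ t) σ)) (Par-concatMap (λ v → (v ∷ᵇ t) ∷ []) (λ v → map (λ v' → v ∷ᵇ v' ∷ᵇ R) σ') σ st) ↭-refl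
  where
  st : ∀ v → Par ((v ∷ᵇ t) ∷ []) (map (λ v' → v ∷ᵇ v' ∷ᵇ R) σ')
  st v = Par-resp ↭-refl (Par-step (ξ-bag (≃-trans (≃-cons ≃-refl tq) ≃-swap) r'))
           (map-≃-pointwise _ _ (λ v' → ≃-swap) σ')

→r-local-diamond : ∀ {s} {e : Exp s} {σ0 σ1} → e →r σ0 → e →r σ1 → Σ[ ρ ∈ Sum s ] (Par σ0 ρ × Par σ1 ρ)
→r-local-diamond β β = _ , Par-refl _ , Par-refl _
→r-local-diamond (β {u} {b}) (ξ-appˡ (ξ-lam {σ = σ} r)) = _ , msubst-body-step {b = b} r , β-map-lam {b = b} σ
→r-local-diamond (β {u} {b}) (ξ-appʳ {τ = τ} r) = _ , msubst-arg-step {u = u} r , β-map {u = u} τ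
→r-local-diamond (ξ-appˡ {b = b} (ξ-lam {σ = σ} r)) β = _ , β-map-lam {b = b} σ , msubst-body-step {b = b} r
→r-local-diamond (ξ-appʳ {u = lam u} {τ = τ} r) β = _ , β-map {u = u} τ , msubst-arg-step {u = u} r
→r-local-diamond (ξ-lam r) (ξ-lam r') with →r-local-diamond r r'
... | ρ , P , Q = map lam ρ , Par-lam P , Par-lam Q
→r-local-diamond (ξ-appˡ {b = b} r) (ξ-appˡ r') with →r-local-diamond r r'
... | ρ , P , Q = map (λ x → app x b) ρ , Par-map-appˡ b P , Par-map-appˡ b Q
→r-local-diamond (ξ-appʳ {u = u} r) (ξ-appʳ r') with →r-local-diamond r r'
... | ρ , P , Q = map (app u) ρ , Par-map-appʳ u P , Par-map-appʳ u Q
→r-local-diamond (ξ-appˡ r) (ξ-appʳ r') with app-steps-join r r'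
... | P , Q = _ , P , Q
→r-local-diamond (ξ-appʳ r') (ξ-appˡ r) with app-steps-join r r'
... | P , Q = _ , Q , P
-- Two steps in one monomial rewrite either the same element, up to ≃, or two distinct
-- elements, which commute.
→r-local-diamond (ξ-bag {t = t} {σ = σ} q r) (ξ-bag {u = u'} {t = t'} {σ = σ'} q' r')
  with ∷-↭-∷-inv (≃⇒bagToList-↭ (≃-trans (≃-sym q) q'))
... | inj₁ (e , tt') with →r-≃ r' (≃-sym e)
...   | σ'' , r'' , eq with →r-local-diamond r r''
...     | ρ , P , Q = map (_∷ᵇ t) ρ , Par-map-∷ᵇˡ t P ,
          Par-resp (map-≃-pointwise _ _ (λ x → ≃-cons ≃-refl (≃-sym tt≃)) σ' ⊚ map-≈ (_∷ᵇ t) (λ z → ≃-cons z ≃-refl) eq) (Par-map-∷ᵇˡ t Q) ↭-refl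
  where
  tt≃ : t ≃ t'
  tt≃ = ≃-trans (↭⇒bag-≃ tt') (≡⇒≃ (listToBag-bagToList t'))
→r-local-diamond (ξ-bag {t = t} {σ = σ} q r) (ξ-bag {u = u'} {t = t'} {σ = σ'} q' r')
    | inj₂ (zs , p1 , p2) =
  _ , bag-step-other (↭⇒bag-≃ p1) r' , Par-resp ↭-refl (bag-step-other (↭⇒bag-≃ p2) r) (∷ᵇ∷ᵇ-swap-sum {σ} {σ'} (listToBag zs))

-- Joining reductions of sums

All-remove : ∀ {A : Set} {P : A → Set} xs {y ys} → All P (xs ++ y ∷ ys) → All P (xs ++ ys) × P y
All-remove [] (p ∷ ps) = ps , p
All-remove (x ∷ xs) (p ∷ ps) with All-remove xs ps
... | a , b = p ∷ a , b

Pointwise-split : ∀ {s} {A : Set} (f : A → Exp s) (qs : List A) P {x} Q → PW.Pointwise _≃_ (map f qs) (P ++ x ∷ Q) →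
  Σ[ qs1 ∈ List A ] Σ[ q ∈ A ] Σ[ qs2 ∈ List A ]
    (qs ≡ qs1 ++ q ∷ qs2 × PW.Pointwise _≃_ (map f qs1) P × f q ≃ x × PW.Pointwise _≃_ (map f qs2) Q)
Pointwise-split f (q ∷ qs) [] Q (e PW.∷ pw) = [] , q , qs , refl , PW.[] , e , pw
Pointwise-split f (q ∷ qs) (p ∷ P) Q (e PW.∷ pw) with Pointwise-split f qs P Q pw
... | qs1 , q' , qs2 , refl , a , b , c = q ∷ qs1 , q' , qs2 , refl , e PW.∷ a , b , c

OptStep-diamond : ∀ {s} {x y : Exp s × Sum s} → OptStep x → OptStep y → proj₁ x ≃ proj₁ y →
        Σ[ ρ ∈ Sum s ] (Par (proj₂ x) ρ × Par (proj₂ y) ρ)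
OptStep-diamond (inj₂ refl) (inj₂ refl) e = _ , Par-refl _ , Par-resp (Hom.prep (≃-sym e) ↭-refl) (Par-refl _) ↭-refl
OptStep-diamond (inj₁ r) (inj₂ refl) e with →r-≃ r e
... | σ'' , r' , eq = _ , Par-refl _ , Par-resp ↭-refl (Par-step r') (↭-sym eq)
OptStep-diamond (inj₂ refl) (inj₁ r) e with →r-≃ r (≃-sym e)
... | σ'' , r' , eq = _ , Par-resp ↭-refl (Par-step r') (↭-sym eq) , Par-refl _
OptStep-diamond (inj₁ r) (inj₁ r') e with →r-≃ r' (≃-sym e)
... | σ'' , r'' , eq with →r-local-diamond r r''
... | ρ , par₀ , par₁ = ρ , par₀ , Par-resp eq par₁ ↭-refl

Par-join : ∀ {s} (ps : List (Exp s × Sum s)) → All OptStep ps → ∀ qs → All OptStep qs → map proj₁ ps ≈ map proj₁ qs →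
       Σ[ ρ ∈ Sum s ] (Par (concatMap proj₂ ps) ρ × Par (concatMap proj₂ qs) ρ)
Par-join [] [] qs B p with xs↭ys⇒|xs|≡|ys| p
Par-join [] [] [] B p | _ = [] , Par-[] , Par-[]
Par-join ((e , σ) ∷ ps) (a ∷ A) qs B p with ↭-split e [] (map proj₁ ps) (↭-sym p)
... | P , Q , pw , pq with Pointwise-split proj₁ qs P Q pw
... | qs1 , q , qs2 , refl , w1 , eq , w2 with All-remove qs1 B
... | B' , b with OptStep-diamond a b (≃-sym eq)
... | ρ0 , par₀ , par₁ with Par-join ps A (qs1 ++ qs2) B'
        (↭-sym pq ⊚ Hom.refl (PW.symmetric ≃-sym (PW.++⁺ w1 w2)) ⊚ ↭-reflexive (sym (map-++ proj₁ qs1 qs2)))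
... | ρ1 , par₀' , par₁' = ρ0 ++ ρ1 , Par-++ par₀ par₀' ,
      Par-resp (↭-reflexive (concatMap-++ proj₂ qs1 (q ∷ qs2)) ⊚ shifts (concatMap proj₂ qs1) (proj₂ q)
                 ⊚ ↭-reflexive (cong (proj₂ q ++_) (sym (concatMap-++ proj₂ qs1 qs2))))
               (Par-++ par₁ par₁') ↭-refl

lemma3p11 : {s : Sort} (ε ε₀ ε₁ : Sum s) → ε →rₛ ε₀ → ε →rₛ ε₁ →
    ∃ (λ ε' → (ε₀ →rₛ⁼ ε') × (ε₁ →rₛ⁼ ε'))
lemma3p11 _ _ _ (sum-step e₀ σ₀ ps r₀ steps₀ src₀ tgt₀) (sum-step e₁ σ₁ qs r₁ steps₁ src₁ tgt₁)
  with Par-join ((e₀ , σ₀) ∷ ps) (inj₁ r₀ ∷ steps₀) ((e₁ , σ₁) ∷ qs) (inj₁ r₁ ∷ steps₁) (↭-sym src₀ ⊚ src₁)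
... | ρ , par₀ , par₁ = ρ , Par⇒→rₛ⁼ (Par-resp tgt₀ par₀ ↭-refl) , Par⇒→rₛ⁼ (Par-resp tgt₁ par₁ ↭-refl)
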